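{- Let $q$ be a prime power and let $d, r, m$ be positive integers with $r < m$. Let $\mathbf{n} = (n_1,\ldots,n_d)\in\mathbb{N}^d$, $N = n_1+\cdots+n_d$ and $\min(\mathbf{n}) = \min(n_1,\ldots,n_d)$. Then the number $\alpha_q(\mathbf{n})$ of $d$-tuples $(p_1,\ldots,p_d)$ of monic polynomials in $F_q[x]$ with $\deg p_i = n_i$ such that the multiplicity of each irreducible factor of $\gcd(p_1,\ldots,p_d)$ is congruent to one of $0,1,\ldots,r-1$ modulo $m$ is $$\alpha_q(\mathbf{n}) = q^{N}\left(1 + q^{1-md} + \cdots + q^{\lfloor \min(\mathbf{n})/m\rfloor (1-md)}\right)$$ if $\min(\mathbf{n}) < r$, and $$\alpha_q(\mathbf{n}) = q^{N}\left(1 + q^{1-md} + \cdots + q^{\lfloor \min(\mathbf{n})/m\rfloor (1-md)}\right) - q^{N-rd+1}\left(1 + q^{1-md} + \cdots + q^{\lfloor (\min(\mathbf{n})-r)/m\rfloor (1-md)}\right)$$ if $\min(\mathbf{n}) \geq r$.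
   Context: $F_q$ is the finite field with $q$ elements. The multiplicity condition refers to every monic irreducible polynomial $s$ dividing the greatest common divisor, i.e. to $\min_i \mathrm{mult}(p_i;s)$ for each such $s$. -}

module Defs where

open import Level using (0ℓ)
open import Data.Nat using (ℕ; zero; suc; _+_; _*_; _^_; _≤_; _<_; _⊓_)
open import Data.Nat.Primality using (Prime)
open import Data.Fin using (Fin; zero; suc)
open import Data.Vec using (Vec; []; _∷_; toList)
open import Data.List using (List; []; _∷_; [_]; map; concatMap; _++_; allFin)
open import Data.Product using (Σ; ∃; _×_; _,_)
open import Relation.Binary.PropositionalEquality using (_≡_; _≢_)
open import Relation.Nullary using (¬_)
open import Algebra.Structures using (IsCommutativeRing)

IsPrimePower : ℕ → Set
IsPrimePower q = Σ ℕ λ p → Σ ℕ λ k → Prime p × 1 ≤ k × q ≡ p ^ k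

-- A finite field with q elements, presented on the carrier Fin q
-- (every field with q elements is isomorphic to one of these).
record FiniteField (q : ℕ) : Set where
  field
    _⊕_ _⊗_ : Fin q → Fin q → Fin q
    ⊖_      : Fin q → Fin q
    0# 1#   : Fin q
    isCommutativeRing : IsCommutativeRing _≡_ _⊕_ _⊗_ ⊖_ 0# 1#
    0≢1     : 0# ≢ 1#
    inverse : ∀ x → x ≢ 0# → Σ (Fin q) λ y → x ⊗ y ≡ 1#

module Poly {q : ℕ} (F : FiniteField q) where
  open FiniteField F

  -- polynomials as coefficient lists, lowest degree first
  addL : List (Fin q) → List (Fin q) → List (Fin q)
  addL []       ys       = ys
  addL (x ∷ xs) []       = x ∷ xs
  addL (x ∷ xs) (y ∷ ys) = (x ⊕ y) ∷ addL xs ys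

  mulL : List (Fin q) → List (Fin q) → List (Fin q)
  mulL []       ys = []
  mulL (a ∷ xs) ys = addL (map (a ⊗_) ys) (0# ∷ mulL xs ys)

  -- a monic polynomial of degree n is given by its n lower coefficients
  -- c : Vec (Fin q) n, standing for c₀ + c₁x + … + c_{n-1}x^{n-1} + x^n
  monic : ∀ {n} → Vec (Fin q) n → List (Fin q)
  monic c = toList c ++ [ 1# ]

  -- divisibility of monic polynomials (the cofactor is then monic)
  _∣P_ : List (Fin q) → List (Fin q) → Set
  a ∣P b = Σ ℕ λ k → Σ (Vec (Fin q) k) λ t → mulL a (monic t) ≡ b

  powL : List (Fin q) → ℕ → List (Fin q)
  powL s zero    = [ 1# ]
  powL s (suc e) = mulL s (powL s e)

  Irreducible : ∀ {k} → Vec (Fin q) k → Set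
  Irreducible {k} s = 1 ≤ k ×
    (∀ a b (u : Vec (Fin q) (suc a)) (v : Vec (Fin q) (suc b)) →
       mulL (monic u) (monic v) ≢ monic s)

  Tuple : ∀ d → (Fin d → ℕ) → Set
  Tuple d n = (i : Fin d) → Vec (Fin q) (n i)

  MinMult : ∀ {d n k} → Tuple d n → Vec (Fin q) k → ℕ → Set
  MinMult p s e = (∀ i → powL (monic s) e ∣P monic (p i))
                × ∃ λ i → ¬ (powL (monic s) (suc e) ∣P monic (p i))

  Good : ∀ {d n} (r m : ℕ) → .{{_ : Data.Nat.NonZero m}} → Tuple d n → Set
  Good r m p = ∀ k (s : Vec (Fin q) k) → Irreducible s →
    (∀ i → monic s ∣P monic (p i)) →
    ∀ e → MinMult p s e → (e Data.Nat.% m) < r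

  allVec : ∀ n → List (Vec (Fin q) n)
  allVec zero    = [ [] ]
  allVec (suc n) = concatMap (λ a → map (a ∷_) (allVec n)) (allFin q)

  consT : ∀ {d n} → Vec (Fin q) (n zero) → Tuple d (λ i → n (suc i)) → Tuple (suc d) n
  consT v t zero    = v
  consT v t (suc i) = t i

  allTuples : ∀ d n → List (Tuple d n)
  allTuples zero    n = [ (λ ()) ]
  allTuples (suc d) n =
    concatMap (λ v → map (consT v) (allTuples d (λ i → n (suc i)))) (allVec (n zero))

sumTo : ℕ → (ℕ → ℕ) → ℕ
sumTo zero    f = f 0
sumTo (suc k) f = sumTo k f + f (suc k)

sumAll : ∀ d → (Fin d → ℕ) → ℕ
sumAll zero    n = 0
sumAll (suc d) n = n zero + sumAll d (λ i → n (suc i))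

-- min(n₁,…,n_d) (d ≥ 1; value 0 for d = 0 is never used)
minAll : ∀ d → (Fin d → ℕ) → ℕ
minAll zero          n = 0
minAll (suc zero)    n = n zero
minAll (suc (suc d)) n = n zero ⊓ minAll (suc d) (λ i → n (suc i))

{-# OPTIONS --safe #-}
module Submission where

-- Every tuple P of monic polynomials (d ≥ 1) factors uniquely as P = c^k ⋆ P′ with c monic and P′
-- k-power-free, i.e. no s^k with s irreducible divides all components of P′. For k = m the minimal
-- multiplicity of an irreducible s in P is m·v_s(c) + (its minimal multiplicity in P′), and the latter
-- is below m; so P is good iff P′ is r-power-free. Grouping tuples by j = deg c gives
-- α(n) = Σ_j q^j D_r(n − mj), where D_r(n) counts the r-power-free tuples of degrees n. The same
-- decomposition with k = r, applied to all q^N tuples, gives q^N = Σ_j q^j D_r(n − rj), hence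
-- D_r(n) = q^N when min n < r and D_r(n) = q^N − q^(N − rd + 1) otherwise. Polynomials are coefficient lists compared coefficientwise; unique factorisation enters
-- only through Euclid's lemma for irreducibles.

open import Defs

open import Algebra.Bundles using (CommutativeRing)
open import Data.Empty using (⊥; ⊥-elim)
open import Data.Fin as Fin using (Fin)
import Data.Fin.Properties as Fin
open import Data.List
  using (List; []; _∷_; [_]; _++_; _∷ʳ_; length; map; concatMap; filter; upTo; allFin;
         cartesianProductWith; cartesianProduct; initLast; _∷ʳ′_)
import Data.List.Properties as List
open import Data.List.Membership.Propositional using (_∈_; find; lose)
open import Data.List.Membership.Propositional.Properties
  using (∈-concatMap⁺; ∈-concatMap⁻; ∈-map⁺; ∈-map⁻; ∈-allFin; ∈-upTo⁺; ∈-upTo⁻; ∈-filter⁺; ∈-filter⁻;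
         ∈-cartesianProductWith⁺; ∈-cartesianProductWith⁻; ∈-cartesianProduct⁺; ∈-cartesianProduct⁻)
open import Data.List.Membership.Propositional.Properties.WithK using (unique∧set⇒bag)
open import Data.List.Relation.Binary.BagAndSetEquality using (∼bag⇒↭)
open import Data.List.Relation.Binary.Permutation.Propositional.Properties using (↭-length)
import Data.List.Relation.Unary.All as All
open import Data.List.Relation.Unary.AllPairs using ([]; _∷_)
open import Data.List.Relation.Unary.Any as Any using (here; any?)
open import Data.List.Relation.Unary.Unique.Propositional using (Unique)
import Data.List.Relation.Unary.Unique.Propositional.Properties as Unique
open import Data.Nat
  using (ℕ; zero; suc; _+_; _*_; _∸_; _^_; _≤_; _<_; _/_; _%_; _⊓_; NonZero; >-nonZero; z≤n; s≤s; _≤?_)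
open import Data.Nat.DivMod
  using (m/n*n≤m; m*n/n≡m; /-monoˡ-≤; [m+kn]%n≡m%n; m<n⇒m%n≡m; m<n⇒m/n≡0; m/n≡1+[m∸n]/n)
open import Data.Nat.Induction using (<-wellFounded)
import Data.Nat.Properties as ℕ
open import Data.Product as Product using (∃; ∃₂; _×_; _,_; proj₁; proj₂; uncurry)
open import Data.Sum using (_⊎_; inj₁; inj₂)
open import Data.Vec as Vec using (Vec; toList; fromList)
import Data.Vec.Properties as Vec
open import Function using (_∘_; id)
open import Function.Bundles using (_⇔_; mk⇔; Equivalence)
open import Induction.WellFounded using (Acc; acc)
open import Level using (0ℓ)
open import Relation.Binary.Bundles using (Setoid)
open import Relation.Binary.Definitions using (tri<; tri≈; tri>)
open import Relation.Binary.PropositionalEquality hiding ([_]; J)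
import Relation.Binary.Reasoning.Setoid as SetoidReasoning
open import Relation.Nullary using (¬_; Dec; yes; no)
open import Relation.Nullary.Decidable as Dec using (_×-dec_)
open import Relation.Unary using (Decidable; _≐_)

open import Algebra.Properties.CommutativeSemigroup ℕ.+-commutativeSemigroup
  using () renaming (interchange to +-interchange)

sumTo-cong : ∀ J {f g : ℕ → ℕ} → (∀ j → j ≤ J → f j ≡ g j) → sumTo J f ≡ sumTo J g
sumTo-cong zero    f≡g = f≡g 0 z≤n
sumTo-cong (suc J) f≡g =
  cong₂ _+_ (sumTo-cong J λ j j≤J → f≡g j (ℕ.m≤n⇒m≤1+n j≤J)) (f≡g (suc J) ℕ.≤-refl)

sumTo-+ : ∀ J f g → sumTo J f + sumTo J g ≡ sumTo J (λ j → f j + g j)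
sumTo-+ zero    f g = refl
sumTo-+ (suc J) f g = begin
  (sumTo J f + f (suc J)) + (sumTo J g + g (suc J)) ≡⟨ +-interchange (sumTo J f) _ _ _ ⟩
  (sumTo J f + sumTo J g) + (f (suc J) + g (suc J)) ≡⟨ cong (_+ (f (suc J) + g (suc J))) (sumTo-+ J f g) ⟩
  sumTo J (λ j → f j + g j) + (f (suc J) + g (suc J)) ∎
  where
  open ≡-Reasoning

*-distribˡ-sumTo : ∀ J c f → c * sumTo J f ≡ sumTo J (λ j → c * f j)
*-distribˡ-sumTo zero    c f = refl
*-distribˡ-sumTo (suc J) c f =
  trans (ℕ.*-distribˡ-+ c (sumTo J f) (f (suc J))) (cong (_+ c * f (suc J)) (*-distribˡ-sumTo J c f))

sumTo-suc : ∀ J f → sumTo (suc J) f ≡ f 0 + sumTo J (λ j → f (suc j))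
sumTo-suc zero    f = refl
sumTo-suc (suc J) f = trans (cong (_+ f (suc (suc J))) (sumTo-suc J f)) (ℕ.+-assoc (f 0) _ _)

sumTo-+-partial : ∀ {J′} J (f g h : ℕ → ℕ) → J′ ≤ J →
  (∀ j → j ≤ J′ → f j + g j ≡ h j) → (∀ j → J′ < j → j ≤ J → f j ≡ h j) →
  sumTo J f + sumTo J′ g ≡ sumTo J h
sumTo-+-partial {J′} J f g h J′≤J paired unpaired with ℕ.m≤n⇒m<n∨m≡n J′≤J
... | inj₂ refl = trans (sumTo-+ J f g) (sumTo-cong J paired)
sumTo-+-partial {J′} (suc J) f g h J′≤J paired unpaired | inj₁ J′<1+J = begin
  (sumTo J f + f (suc J)) + sumTo J′ g ≡⟨ ℕ.+-assoc (sumTo J f) _ _ ⟩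
  sumTo J f + (f (suc J) + sumTo J′ g) ≡⟨ cong (sumTo J f +_) (ℕ.+-comm (f (suc J)) _) ⟩
  sumTo J f + (sumTo J′ g + f (suc J)) ≡⟨ ℕ.+-assoc (sumTo J f) _ _ ⟨
  (sumTo J f + sumTo J′ g) + f (suc J) ≡⟨ cong₂ _+_ ih (unpaired (suc J) J′<1+J ℕ.≤-refl) ⟩
  sumTo J h + h (suc J) ∎
  where
  open ≡-Reasoning
  ih = sumTo-+-partial J f g h (ℕ.≤-pred J′<1+J) paired
         (λ j J′<j j≤J → unpaired j J′<j (ℕ.m≤n⇒m≤1+n j≤J))

find-drop : ∀ {A : ℕ → Set} → Decidable A → ∀ {j₀} B → j₀ ≤ B → A j₀ → ¬ A B →
  ∃ λ j → j₀ ≤ j × j < B × A j × ¬ A (suc j)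
find-drop {A} A? zero    j₀≤0 Aj₀ ¬AB = ⊥-elim (¬AB (subst A (ℕ.n≤0⇒n≡0 j₀≤0) Aj₀))
find-drop {A} A? {j₀} (suc B) j₀≤1+B Aj₀ ¬A1+B with j₀ ≤? B
... | no  j₀≰B = ⊥-elim (¬A1+B (subst A (ℕ.≤-antisym j₀≤1+B (ℕ.≰⇒> j₀≰B)) Aj₀))
... | yes j₀≤B with A? B
...   | yes AB = B , j₀≤B , ℕ.≤-refl , AB , ¬A1+B
...   | no ¬AB = let j , j₀≤j , j<B , Aj , ¬A1+j = find-drop A? B j₀≤B Aj₀ ¬AB
                 in j , j₀≤j , ℕ.m≤n⇒m≤1+n j<B , Aj , ¬A1+j

[m*v+j]%m≡j : ∀ m v j .{{_ : NonZero m}} → j < m → (m * v + j) % m ≡ j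
[m*v+j]%m≡j m v j j<m = begin
  (m * v + j) % m   ≡⟨ cong (_% m) (trans (ℕ.+-comm (m * v) j) (cong (j +_) (ℕ.*-comm m v))) ⟩
  (j + v * m) % m   ≡⟨ [m+kn]%n≡m%n j v m ⟩
  j % m             ≡⟨ m<n⇒m%n≡m j<m ⟩
  j                 ∎
  where open ≡-Reasoning

≤/⇒*≤ : ∀ {k a j} .{{_ : NonZero k}} → j ≤ a / k → k * j ≤ a
≤/⇒*≤ {k} {a} {j} j≤a/k = ℕ.≤-trans (ℕ.≤-reflexive (ℕ.*-comm k j)) (ℕ.≤-trans (ℕ.*-monoˡ-≤ k j≤a/k) (m/n*n≤m a k))

*≤⇒≤/ : ∀ {k a j} .{{_ : NonZero k}} → k * j ≤ a → j ≤ a / k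
*≤⇒≤/ {k} {a} {j} kj≤a = subst (_≤ a / k) (m*n/n≡m j k) (/-monoˡ-≤ k (ℕ.≤-trans (ℕ.≤-reflexive (ℕ.*-comm j k)) kj≤a))

∸-swap-≤ : ∀ {a b o} → b ≤ o → a ≤ o ∸ b → b ≤ o ∸ a
∸-swap-≤ {a} {b} {o} b≤o a≤o∸b = ℕ.m+n≤o⇒m≤o∸n b (subst (_≤ o) (ℕ.+-comm a b) (ℕ.m≤o∸n⇒m+n≤o a b≤o a≤o∸b))

+-∸-cancel : ∀ {a b c} x → a + b ≡ c → c + x ∸ b ≡ x + a
+-∸-cancel {a} {b} x refl = begin
  a + b + x ∸ b     ≡⟨ cong (_∸ b) (ℕ.+-comm (a + b) x) ⟩
  x + (a + b) ∸ b   ≡⟨ cong (_∸ b) (ℕ.+-assoc x a b) ⟨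
  x + a + b ∸ b     ≡⟨ ℕ.m+n∸n≡m (x + a) b ⟩
  x + a             ∎
  where open ≡-Reasoning

module _ {A : Set} where

  length-concatMap-upTo : ∀ (g : ℕ → List A) J →
    length (concatMap g (upTo (suc J))) ≡ sumTo J (λ j → length (g j))
  length-concatMap-upTo g zero    = cong length (List.++-identityʳ (g 0))
  length-concatMap-upTo g (suc J) = begin
    length (concatMap g (upTo (suc (suc J))))        ≡⟨ cong (length ∘ concatMap g) (List.upTo-∷ʳ (suc J)) ⟨
    length (concatMap g (upTo (suc J) ++ [ suc J ])) ≡⟨ cong length (List.concatMap-++ g (upTo (suc J)) _) ⟩
    length (concatMap g (upTo (suc J)) ++ (g (suc J) ++ [])) ≡⟨ List.length-++ (concatMap g (upTo (suc J))) ⟩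
    length (concatMap g (upTo (suc J))) + length (g (suc J) ++ [])
      ≡⟨ cong₂ _+_ (length-concatMap-upTo g J) (cong length (List.++-identityʳ (g (suc J)))) ⟩
    sumTo (suc J) (λ j → length (g j)) ∎
    where open ≡-Reasoning

  -- the blocks g j are disjoint because `tag` recovers j from each element
  concatMap-Unique : ∀ (g : ℕ → List A) (tag : A → ℕ) →
    (∀ j → Unique (g j)) → (∀ j {x} → x ∈ g j → tag x ≡ j) →
    ∀ {js} → Unique js → Unique (concatMap g js)
  concatMap-Unique g tag uniq tagged {[]}     _            = []
  concatMap-Unique g tag uniq tagged {j ∷ js} (j∉js ∷ ujs) =
    Unique.++⁺ (uniq j) (concatMap-Unique g tag uniq tagged ujs) disjoint
    where
    disjoint : ∀ {x} → ¬ (x ∈ g j × x ∈ concatMap g js)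
    disjoint (x∈gj , x∈rest) with find (∈-concatMap⁻ g x∈rest)
    ... | j′ , j′∈js , x∈gj′ = All.lookup j∉js j′∈js (trans (sym (tagged j x∈gj)) (tagged j′ x∈gj′))

  ∷ʳ-split : ∀ (xs : List A) → 0 < length xs → ∃₂ λ ys y → xs ≡ ys ∷ʳ y
  ∷ʳ-split xs 0<xs with initLast xs
  ... | ys ∷ʳ′ y = ys , y , refl

  concatMap-map≡cartesianProductWith : ∀ {B C : Set} (f : A → B → C) xs ys →
    concatMap (λ x → map (f x) ys) xs ≡ cartesianProductWith f xs ys
  concatMap-map≡cartesianProductWith f []       ys = refl
  concatMap-map≡cartesianProductWith f (x ∷ xs) ys = cong (map (f x) ys ++_) (concatMap-map≡cartesianProductWith f xs ys)

  length-cartesianProductWith : ∀ {B C : Set} (f : A → B → C) xs ys →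
    length (cartesianProductWith f xs ys) ≡ length xs * length ys
  length-cartesianProductWith f []       ys = refl
  length-cartesianProductWith f (x ∷ xs) ys =
    trans (List.length-++ (map (f x) ys)) (cong₂ _+_ (List.length-map (f x) ys) (length-cartesianProductWith f xs ys))

  length-filter-map : ∀ {B : Set} {P : B → Set} (P? : Decidable P) (f : A → B) xs →
    length (filter P? (map f xs)) ≡ length (filter (P? ∘ f) xs)
  length-filter-map P? f []       = refl
  length-filter-map P? f (x ∷ xs) with P? (f x)
  ... | yes _ = cong suc (length-filter-map P? f xs)
  ... | no  _ = length-filter-map P? f xs

  length-Unique-≡ : ∀ {xs ys : List A} → Unique xs → Unique ys →
    (∀ {x} → x ∈ xs ⇔ x ∈ ys) → length xs ≡ length ys
  length-Unique-≡ uxs uys xs⇔ys = ↭-length (∼bag⇒↭ (unique∧set⇒bag uxs uys xs⇔ys))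

infixl 6 _∸ᵛ_
_∸ᵛ_ : ∀ {d} → (Fin d → ℕ) → ℕ → (Fin d → ℕ)
(n ∸ᵛ a) i = n i ∸ a

sumAll-∸ᵛ : ∀ d (n : Fin d → ℕ) a → (∀ i → a ≤ n i) → sumAll d (n ∸ᵛ a) + d * a ≡ sumAll d n
sumAll-∸ᵛ zero    n a a≤n = refl
sumAll-∸ᵛ (suc d) n a a≤n = begin
  (n Fin.zero ∸ a + R) + (a + d * a) ≡⟨ +-interchange (n Fin.zero ∸ a) R a (d * a) ⟩
  (n Fin.zero ∸ a + a) + (R + d * a) ≡⟨ cong₂ _+_ (ℕ.m∸n+n≡m (a≤n Fin.zero)) (sumAll-∸ᵛ d (n ∘ Fin.suc) a (a≤n ∘ Fin.suc)) ⟩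
  n Fin.zero + sumAll d (n ∘ Fin.suc) ∎
  where
  open ≡-Reasoning
  R = sumAll d ((n ∸ᵛ a) ∘ Fin.suc)

minAll-≤ : ∀ d (n : Fin (suc d) → ℕ) i → minAll (suc d) n ≤ n i
minAll-≤ zero    n Fin.zero    = ℕ.≤-refl
minAll-≤ (suc d) n Fin.zero    = ℕ.m⊓n≤m _ _
minAll-≤ (suc d) n (Fin.suc i) = ℕ.≤-trans (ℕ.m⊓n≤n _ _) (minAll-≤ d (n ∘ Fin.suc) i)

minAll-greatest : ∀ d (n : Fin (suc d) → ℕ) {a} → (∀ i → a ≤ n i) → a ≤ minAll (suc d) n
minAll-greatest zero    n a≤n = a≤n Fin.zero
minAll-greatest (suc d) n a≤n = ℕ.⊓-glb (a≤n Fin.zero) (minAll-greatest d (n ∘ Fin.suc) (a≤n ∘ Fin.suc))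

minAll-∸ᵛ : ∀ d (n : Fin (suc d) → ℕ) a → minAll (suc d) (n ∸ᵛ a) ≡ minAll (suc d) n ∸ a
minAll-∸ᵛ zero    n a = refl
minAll-∸ᵛ (suc d) n a = trans (cong ((n Fin.zero ∸ a) ⊓_) (minAll-∸ᵛ d (n ∘ Fin.suc) a))
                               (sym (ℕ.∸-distribʳ-⊓ a (n Fin.zero) _))

module Polynomials {q : ℕ} (F : FiniteField q) where

  open FiniteField F
  open Poly F

  𝔽-ring : CommutativeRing 0ℓ 0ℓ
  𝔽-ring = record { isCommutativeRing = isCommutativeRing }

  open CommutativeRing 𝔽-ring using
    (+-assoc; +-comm; +-identityˡ; +-identityʳ; -‿inverseʳ;
     *-assoc; *-comm; *-identityˡ; *-identityʳ; distribˡ; distribʳ; zeroˡ; zeroʳ;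
     +-commutativeSemigroup; +-group; ring)
  open import Algebra.Properties.CommutativeSemigroup +-commutativeSemigroup
    using () renaming (interchange to ⊕-interchange)
  open import Algebra.Properties.Group +-group using (x∙y⁻¹≈ε⇒x≈y)
  open import Algebra.Properties.Ring ring using (-1*x≈-x)

  1≢0 : 1# ≢ 0#
  1≢0 = 0≢1 ∘ sym

  inv : ∀ a → a ≢ 0# → Fin q
  inv a a≢0 = proj₁ (inverse a a≢0)

  inv-inverseˡ : ∀ a (a≢0 : a ≢ 0#) → inv a a≢0 ⊗ a ≡ 1#
  inv-inverseˡ a a≢0 = trans (*-comm _ a) (proj₂ (inverse a a≢0))

  ⊗-nonZero : ∀ {a b} → a ≢ 0# → b ≢ 0# → a ⊗ b ≢ 0#
  ⊗-nonZero {a} {b} a≢0 b≢0 ab≡0 = b≢0 (begin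
    b                      ≡⟨ *-identityˡ b ⟨
    1# ⊗ b                 ≡⟨ cong (_⊗ b) (inv-inverseˡ a a≢0) ⟨
    (inv a a≢0 ⊗ a) ⊗ b   ≡⟨ *-assoc _ a b ⟩
    inv a a≢0 ⊗ (a ⊗ b)   ≡⟨ cong (inv a a≢0 ⊗_) ab≡0 ⟩
    inv a a≢0 ⊗ 0#        ≡⟨ zeroʳ _ ⟩
    0# ∎)
    where open ≡-Reasoning

  -- Polynomials as coefficient lists

  Pol : Set
  Pol = List (Fin q)

  coeff : Pol → ℕ → Fin q
  coeff []       n       = 0#
  coeff (x ∷ xs) zero    = x
  coeff (x ∷ xs) (suc n) = coeff xs n

  infix 4 _≈_
  record _≈_ (xs ys : Pol) : Set where
    constructor coeffwise
    field coeff-≡ : ∀ n → coeff xs n ≡ coeff ys n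
  open _≈_

  ≈-refl : ∀ {xs} → xs ≈ xs
  ≈-refl = coeffwise λ n → refl

  ≈-sym : ∀ {xs ys} → xs ≈ ys → ys ≈ xs
  ≈-sym xs≈ys = coeffwise (sym ∘ coeff-≡ xs≈ys)

  ≈-trans : ∀ {xs ys zs} → xs ≈ ys → ys ≈ zs → xs ≈ zs
  ≈-trans xs≈ys ys≈zs = coeffwise λ n → trans (coeff-≡ xs≈ys n) (coeff-≡ ys≈zs n)

  ≈-reflexive : ∀ {xs ys} → xs ≡ ys → xs ≈ ys
  ≈-reflexive refl = ≈-refl

  ≈-setoid : Setoid 0ℓ 0ℓ
  ≈-setoid = record { Carrier = Pol ; _≈_ = _≈_
                    ; isEquivalence = record { refl = ≈-refl ; sym = ≈-sym ; trans = ≈-trans } }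

  module ≈-Reasoning = SetoidReasoning ≈-setoid

  ∷-cong : ∀ {x y xs ys} → x ≡ y → xs ≈ ys → (x ∷ xs) ≈ (y ∷ ys)
  ∷-cong x≡y xs≈ys = coeffwise λ { zero → x≡y ; (suc n) → coeff-≡ xs≈ys n }

  ∷-injectiveʳ : ∀ {x y xs ys} → (x ∷ xs) ≈ (y ∷ ys) → xs ≈ ys
  ∷-injectiveʳ eq = coeffwise (coeff-≡ eq ∘ suc)

  ∷-≈-[]⇒tail : ∀ {x xs} → (x ∷ xs) ≈ [] → xs ≈ []
  ∷-≈-[]⇒tail eq = coeffwise (coeff-≡ eq ∘ suc)

  0∷-≈-[] : ∀ {xs} → xs ≈ [] → (0# ∷ xs) ≈ []
  0∷-≈-[] xs≈[] = coeffwise λ { zero → refl ; (suc n) → coeff-≡ xs≈[] n }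

  scale : Fin q → Pol → Pol
  scale a = map (a ⊗_)

  negate : Pol → Pol
  negate = scale (⊖ 1#)

  coeff-addL : ∀ xs ys n → coeff (addL xs ys) n ≡ coeff xs n ⊕ coeff ys n
  coeff-addL []       ys       n       = sym (+-identityˡ _)
  coeff-addL (x ∷ xs) []       zero    = sym (+-identityʳ x)
  coeff-addL (x ∷ xs) []       (suc n) = sym (+-identityʳ _)
  coeff-addL (x ∷ xs) (y ∷ ys) zero    = refl
  coeff-addL (x ∷ xs) (y ∷ ys) (suc n) = coeff-addL xs ys n

  coeff-scale : ∀ a xs n → coeff (scale a xs) n ≡ a ⊗ coeff xs n
  coeff-scale a []       n       = sym (zeroʳ a)
  coeff-scale a (x ∷ xs) zero    = refl
  coeff-scale a (x ∷ xs) (suc n) = coeff-scale a xs n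

  coeff-negate : ∀ xs n → coeff (negate xs) n ≡ ⊖ coeff xs n
  coeff-negate xs n = trans (coeff-scale (⊖ 1#) xs n) (-1*x≈-x _)

  addL-cong : ∀ {xs xs′ ys ys′} → xs ≈ xs′ → ys ≈ ys′ → addL xs ys ≈ addL xs′ ys′
  addL-cong {xs} {xs′} {ys} {ys′} xs≈ ys≈ = coeffwise λ n → begin
    coeff (addL xs ys) n        ≡⟨ coeff-addL xs ys n ⟩
    coeff xs n ⊕ coeff ys n     ≡⟨ cong₂ _⊕_ (coeff-≡ xs≈ n) (coeff-≡ ys≈ n) ⟩
    coeff xs′ n ⊕ coeff ys′ n   ≡⟨ coeff-addL xs′ ys′ n ⟨
    coeff (addL xs′ ys′) n      ∎
    where open ≡-Reasoning

  addL-congˡ : ∀ xs {ys ys′} → ys ≈ ys′ → addL xs ys ≈ addL xs ys′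
  addL-congˡ xs = addL-cong (≈-refl {xs})

  scale-cong : ∀ {a b xs ys} → a ≡ b → xs ≈ ys → scale a xs ≈ scale b ys
  scale-cong {a} {b} {xs} {ys} a≡b xs≈ = coeffwise λ n → begin
    coeff (scale a xs) n   ≡⟨ coeff-scale a xs n ⟩
    a ⊗ coeff xs n         ≡⟨ cong₂ _⊗_ a≡b (coeff-≡ xs≈ n) ⟩
    b ⊗ coeff ys n         ≡⟨ coeff-scale b ys n ⟨
    coeff (scale b ys) n   ∎
    where open ≡-Reasoning

  addL-identityʳ : ∀ xs → addL xs [] ≡ xs
  addL-identityʳ []       = refl
  addL-identityʳ (x ∷ xs) = refl

  addL-comm : ∀ xs ys → addL xs ys ≈ addL ys xs
  addL-comm xs ys = coeffwise λ n →
    trans (coeff-addL xs ys n) (trans (+-comm _ _) (sym (coeff-addL ys xs n)))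

  addL-assoc : ∀ xs ys zs → addL (addL xs ys) zs ≈ addL xs (addL ys zs)
  addL-assoc xs ys zs = coeffwise λ n → begin
    coeff (addL (addL xs ys) zs) n           ≡⟨ coeff-addL (addL xs ys) zs n ⟩
    coeff (addL xs ys) n ⊕ coeff zs n        ≡⟨ cong (_⊕ coeff zs n) (coeff-addL xs ys n) ⟩
    (coeff xs n ⊕ coeff ys n) ⊕ coeff zs n   ≡⟨ +-assoc _ _ _ ⟩
    coeff xs n ⊕ (coeff ys n ⊕ coeff zs n)   ≡⟨ cong (coeff xs n ⊕_) (coeff-addL ys zs n) ⟨
    coeff xs n ⊕ coeff (addL ys zs) n        ≡⟨ coeff-addL xs (addL ys zs) n ⟨
    coeff (addL xs (addL ys zs)) n           ∎
    where open ≡-Reasoning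

  addL-interchange : ∀ ws xs ys zs →
    addL (addL ws xs) (addL ys zs) ≈ addL (addL ws ys) (addL xs zs)
  addL-interchange ws xs ys zs = coeffwise λ n → begin
    coeff (addL (addL ws xs) (addL ys zs)) n                  ≡⟨ coeff-addL (addL ws xs) (addL ys zs) n ⟩
    coeff (addL ws xs) n ⊕ coeff (addL ys zs) n               ≡⟨ cong₂ _⊕_ (coeff-addL ws xs n) (coeff-addL ys zs n) ⟩
    (coeff ws n ⊕ coeff xs n) ⊕ (coeff ys n ⊕ coeff zs n)     ≡⟨ ⊕-interchange _ _ _ _ ⟩
    (coeff ws n ⊕ coeff ys n) ⊕ (coeff xs n ⊕ coeff zs n)     ≡⟨ cong₂ _⊕_ (coeff-addL ws ys n) (coeff-addL xs zs n) ⟨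
    coeff (addL ws ys) n ⊕ coeff (addL xs zs) n               ≡⟨ coeff-addL (addL ws ys) (addL xs zs) n ⟨
    coeff (addL (addL ws ys) (addL xs zs)) n                  ∎
    where open ≡-Reasoning

  addL-zeroˡ : ∀ {xs ys} → xs ≈ [] → addL xs ys ≈ ys
  addL-zeroˡ {xs} {ys} xs≈[] = coeffwise λ n →
    trans (coeff-addL xs ys n) (trans (cong (_⊕ coeff ys n) (coeff-≡ xs≈[] n)) (+-identityˡ _))

  addL-zeroʳ : ∀ {xs ys} → ys ≈ [] → addL xs ys ≈ xs
  addL-zeroʳ {xs} {ys} ys≈[] = ≈-trans (addL-comm xs ys) (addL-zeroˡ ys≈[])

  0∷-addL : ∀ xs ys → (0# ∷ addL xs ys) ≈ addL (0# ∷ xs) (0# ∷ ys)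
  0∷-addL xs ys = ∷-cong (sym (+-identityˡ 0#)) ≈-refl

  scale-addL : ∀ a xs ys → scale a (addL xs ys) ≈ addL (scale a xs) (scale a ys)
  scale-addL a xs ys = coeffwise λ n → begin
    coeff (scale a (addL xs ys)) n                ≡⟨ coeff-scale a (addL xs ys) n ⟩
    a ⊗ coeff (addL xs ys) n                      ≡⟨ cong (a ⊗_) (coeff-addL xs ys n) ⟩
    a ⊗ (coeff xs n ⊕ coeff ys n)                 ≡⟨ distribˡ a _ _ ⟩
    (a ⊗ coeff xs n) ⊕ (a ⊗ coeff ys n)           ≡⟨ cong₂ _⊕_ (coeff-scale a xs n) (coeff-scale a ys n) ⟨
    coeff (scale a xs) n ⊕ coeff (scale a ys) n   ≡⟨ coeff-addL (scale a xs) (scale a ys) n ⟨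
    coeff (addL (scale a xs) (scale a ys)) n      ∎
    where open ≡-Reasoning

  addL-scale : ∀ a b xs → addL (scale a xs) (scale b xs) ≈ scale (a ⊕ b) xs
  addL-scale a b xs = coeffwise λ n → begin
    coeff (addL (scale a xs) (scale b xs)) n      ≡⟨ coeff-addL (scale a xs) (scale b xs) n ⟩
    coeff (scale a xs) n ⊕ coeff (scale b xs) n   ≡⟨ cong₂ _⊕_ (coeff-scale a xs n) (coeff-scale b xs n) ⟩
    (a ⊗ coeff xs n) ⊕ (b ⊗ coeff xs n)           ≡⟨ distribʳ _ a b ⟨
    (a ⊕ b) ⊗ coeff xs n                          ≡⟨ coeff-scale (a ⊕ b) xs n ⟨
    coeff (scale (a ⊕ b) xs) n                    ∎
    where open ≡-Reasoning

  scale-scale : ∀ a b xs → scale a (scale b xs) ≈ scale (a ⊗ b) xs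
  scale-scale a b xs = coeffwise λ n → begin
    coeff (scale a (scale b xs)) n   ≡⟨ coeff-scale a (scale b xs) n ⟩
    a ⊗ coeff (scale b xs) n         ≡⟨ cong (a ⊗_) (coeff-scale b xs n) ⟩
    a ⊗ (b ⊗ coeff xs n)             ≡⟨ *-assoc a b _ ⟨
    (a ⊗ b) ⊗ coeff xs n             ≡⟨ coeff-scale (a ⊗ b) xs n ⟨
    coeff (scale (a ⊗ b) xs) n       ∎
    where open ≡-Reasoning

  scale-zero : ∀ xs → scale 0# xs ≈ []
  scale-zero xs = coeffwise λ n → trans (coeff-scale 0# xs n) (zeroˡ _)

  scale-one : ∀ xs → scale 1# xs ≈ xs
  scale-one xs = coeffwise λ n → trans (coeff-scale 1# xs n) (*-identityˡ _)

  addL-negateʳ : ∀ xs → addL xs (negate xs) ≈ []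
  addL-negateʳ xs = coeffwise λ n →
    trans (coeff-addL xs (negate xs) n)
          (trans (cong (coeff xs n ⊕_) (coeff-negate xs n)) (-‿inverseʳ _))

  addL-negate-≈[] : ∀ {xs ys} → addL xs (negate ys) ≈ [] → xs ≈ ys
  addL-negate-≈[] {xs} {ys} xs-ys≈[] = coeffwise λ n → x∙y⁻¹≈ε⇒x≈y _ _ (begin
    coeff xs n ⊕ (⊖ coeff ys n)          ≡⟨ cong (coeff xs n ⊕_) (coeff-negate ys n) ⟨
    coeff xs n ⊕ coeff (negate ys) n     ≡⟨ coeff-addL xs (negate ys) n ⟨
    coeff (addL xs (negate ys)) n        ≡⟨ coeff-≡ xs-ys≈[] n ⟩
    0# ∎)
    where open ≡-Reasoning

  addL-moveˡ : ∀ xs ys zs → addL xs ys ≈ zs → ys ≈ addL zs (negate xs)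
  addL-moveˡ xs ys zs xs+ys≈zs = begin
    ys                                  ≈⟨ addL-zeroˡ (addL-negateʳ xs) ⟨
    addL (addL xs (negate xs)) ys       ≈⟨ addL-assoc xs (negate xs) ys ⟩
    addL xs (addL (negate xs) ys)       ≈⟨ addL-congˡ xs (addL-comm (negate xs) ys) ⟩
    addL xs (addL ys (negate xs))       ≈⟨ addL-assoc xs ys (negate xs) ⟨
    addL (addL xs ys) (negate xs)       ≈⟨ addL-cong xs+ys≈zs ≈-refl ⟩
    addL zs (negate xs)                 ∎
    where open ≈-Reasoning

  mulL-zeroˡ : ∀ {xs} ys → xs ≈ [] → mulL xs ys ≈ []
  mulL-zeroˡ {[]}     ys xs≈[] = ≈-refl
  mulL-zeroˡ {x ∷ xs} ys xs≈[] = begin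
    addL (scale x ys) (0# ∷ mulL xs ys)
      ≈⟨ addL-cong (scale-cong (coeff-≡ xs≈[] 0) ≈-refl) (∷-cong refl (mulL-zeroˡ ys (∷-≈-[]⇒tail xs≈[]))) ⟩
    addL (scale 0# ys) (0# ∷ [])   ≈⟨ addL-zeroˡ (scale-zero ys) ⟩
    0# ∷ []                        ≈⟨ 0∷-≈-[] ≈-refl ⟩
    []                             ∎
    where open ≈-Reasoning

  mulL-zeroʳ : ∀ xs → mulL xs [] ≈ []
  mulL-zeroʳ []       = ≈-refl
  mulL-zeroʳ (x ∷ xs) = 0∷-≈-[] (mulL-zeroʳ xs)

  mulL-congˡ : ∀ {xs xs′} ys → xs ≈ xs′ → mulL xs ys ≈ mulL xs′ ys
  mulL-congˡ {[]}     {[]}       ys xs≈ = ≈-refl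
  mulL-congˡ {[]}     {x′ ∷ xs′} ys xs≈ = ≈-sym (mulL-zeroˡ ys (≈-sym xs≈))
  mulL-congˡ {x ∷ xs} {[]}       ys xs≈ = mulL-zeroˡ ys xs≈
  mulL-congˡ {x ∷ xs} {x′ ∷ xs′} ys xs≈ =
    addL-cong (scale-cong (coeff-≡ xs≈ 0) ≈-refl) (∷-cong refl (mulL-congˡ ys (∷-injectiveʳ xs≈)))

  mulL-congʳ : ∀ xs {ys ys′} → ys ≈ ys′ → mulL xs ys ≈ mulL xs ys′
  mulL-congʳ []       ys≈ = ≈-refl
  mulL-congʳ (x ∷ xs) ys≈ = addL-cong (scale-cong refl ys≈) (∷-cong refl (mulL-congʳ xs ys≈))

  mulL-cong : ∀ {xs xs′ ys ys′} → xs ≈ xs′ → ys ≈ ys′ → mulL xs ys ≈ mulL xs′ ys′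
  mulL-cong {xs′ = xs′} {ys = ys} xs≈ ys≈ = ≈-trans (mulL-congˡ ys xs≈) (mulL-congʳ xs′ ys≈)

  mulL-distribˡ : ∀ xs ys zs → mulL xs (addL ys zs) ≈ addL (mulL xs ys) (mulL xs zs)
  mulL-distribˡ []       ys zs = ≈-refl
  mulL-distribˡ (x ∷ xs) ys zs = begin
    addL (scale x (addL ys zs)) (0# ∷ mulL xs (addL ys zs))
      ≈⟨ addL-cong (scale-addL x ys zs) (∷-cong refl (mulL-distribˡ xs ys zs)) ⟩
    addL (addL (scale x ys) (scale x zs)) (0# ∷ addL (mulL xs ys) (mulL xs zs))
      ≈⟨ addL-congˡ (addL (scale x ys) (scale x zs)) (0∷-addL (mulL xs ys) (mulL xs zs)) ⟩
    addL (addL (scale x ys) (scale x zs)) (addL (0# ∷ mulL xs ys) (0# ∷ mulL xs zs))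
      ≈⟨ addL-interchange (scale x ys) (scale x zs) (0# ∷ mulL xs ys) (0# ∷ mulL xs zs) ⟩
    addL (addL (scale x ys) (0# ∷ mulL xs ys)) (addL (scale x zs) (0# ∷ mulL xs zs)) ∎
    where open ≈-Reasoning

  mulL-distribʳ : ∀ xs ys zs → mulL (addL xs ys) zs ≈ addL (mulL xs zs) (mulL ys zs)
  mulL-distribʳ []       ys       zs = ≈-refl
  mulL-distribʳ (x ∷ xs) []       zs = ≈-reflexive (sym (addL-identityʳ _))
  mulL-distribʳ (x ∷ xs) (y ∷ ys) zs = begin
    addL (scale (x ⊕ y) zs) (0# ∷ mulL (addL xs ys) zs)
      ≈⟨ addL-cong (≈-sym (addL-scale x y zs)) (∷-cong refl (mulL-distribʳ xs ys zs)) ⟩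
    addL (addL (scale x zs) (scale y zs)) (0# ∷ addL (mulL xs zs) (mulL ys zs))
      ≈⟨ addL-congˡ (addL (scale x zs) (scale y zs)) (0∷-addL (mulL xs zs) (mulL ys zs)) ⟩
    addL (addL (scale x zs) (scale y zs)) (addL (0# ∷ mulL xs zs) (0# ∷ mulL ys zs))
      ≈⟨ addL-interchange (scale x zs) (scale y zs) (0# ∷ mulL xs zs) (0# ∷ mulL ys zs) ⟩
    addL (addL (scale x zs) (0# ∷ mulL xs zs)) (addL (scale y zs) (0# ∷ mulL ys zs)) ∎
    where open ≈-Reasoning

  mulL-scaleˡ : ∀ a xs ys → mulL (scale a xs) ys ≈ scale a (mulL xs ys)
  mulL-scaleˡ a []       ys = ≈-refl
  mulL-scaleˡ a (x ∷ xs) ys = begin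
    addL (scale (a ⊗ x) ys) (0# ∷ mulL (scale a xs) ys)
      ≈⟨ addL-cong (≈-sym (scale-scale a x ys)) (∷-cong (sym (zeroʳ a)) (mulL-scaleˡ a xs ys)) ⟩
    addL (scale a (scale x ys)) (scale a (0# ∷ mulL xs ys))
      ≈⟨ scale-addL a (scale x ys) (0# ∷ mulL xs ys) ⟨
    scale a (addL (scale x ys) (0# ∷ mulL xs ys)) ∎
    where open ≈-Reasoning

  mulL-scaleʳ : ∀ a xs ys → mulL xs (scale a ys) ≈ scale a (mulL xs ys)
  mulL-scaleʳ a []       ys = ≈-refl
  mulL-scaleʳ a (x ∷ xs) ys = begin
    addL (scale x (scale a ys)) (0# ∷ mulL xs (scale a ys))
      ≈⟨ addL-cong x•a•ys (∷-cong (sym (zeroʳ a)) (mulL-scaleʳ a xs ys)) ⟩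
    addL (scale a (scale x ys)) (scale a (0# ∷ mulL xs ys))
      ≈⟨ scale-addL a (scale x ys) (0# ∷ mulL xs ys) ⟨
    scale a (addL (scale x ys) (0# ∷ mulL xs ys)) ∎
    where
    open ≈-Reasoning
    x•a•ys : scale x (scale a ys) ≈ scale a (scale x ys)
    x•a•ys = ≈-trans (scale-scale x a ys)
               (≈-trans (scale-cong (*-comm x a) ≈-refl) (≈-sym (scale-scale a x ys)))

  mulL-∷ʳ : ∀ xs y ys → mulL xs (y ∷ ys) ≈ addL (scale y xs) (0# ∷ mulL xs ys)
  mulL-∷ʳ []       y ys = ≈-sym (0∷-≈-[] ≈-refl)
  mulL-∷ʳ (x ∷ xs) y ys = ∷-cong (cong (_⊕ 0#) (*-comm x y)) (begin
    addL (scale x ys) (mulL xs (y ∷ ys))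
      ≈⟨ addL-congˡ (scale x ys) (mulL-∷ʳ xs y ys) ⟩
    addL (scale x ys) (addL (scale y xs) (0# ∷ mulL xs ys))
      ≈⟨ addL-assoc (scale x ys) (scale y xs) (0# ∷ mulL xs ys) ⟨
    addL (addL (scale x ys) (scale y xs)) (0# ∷ mulL xs ys)
      ≈⟨ addL-cong (addL-comm (scale x ys) (scale y xs)) ≈-refl ⟩
    addL (addL (scale y xs) (scale x ys)) (0# ∷ mulL xs ys)
      ≈⟨ addL-assoc (scale y xs) (scale x ys) (0# ∷ mulL xs ys) ⟩
    addL (scale y xs) (addL (scale x ys) (0# ∷ mulL xs ys)) ∎)
    where open ≈-Reasoning

  mulL-comm : ∀ xs ys → mulL xs ys ≈ mulL ys xs
  mulL-comm []       ys = ≈-sym (mulL-zeroʳ ys)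
  mulL-comm (x ∷ xs) ys = ≈-trans (addL-congˡ (scale x ys) (∷-cong refl (mulL-comm xs ys)))
                                   (≈-sym (mulL-∷ʳ ys x xs))

  mulL-0∷ˡ : ∀ xs ys → mulL (0# ∷ xs) ys ≈ (0# ∷ mulL xs ys)
  mulL-0∷ˡ xs ys = addL-zeroˡ (scale-zero ys)

  mulL-0∷ʳ : ∀ xs ys → mulL xs (0# ∷ ys) ≈ (0# ∷ mulL xs ys)
  mulL-0∷ʳ xs ys = ≈-trans (mulL-∷ʳ xs 0# ys) (addL-zeroˡ (scale-zero xs))

  mulL-assoc : ∀ xs ys zs → mulL (mulL xs ys) zs ≈ mulL xs (mulL ys zs)
  mulL-assoc []       ys zs = ≈-refl
  mulL-assoc (x ∷ xs) ys zs = begin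
    mulL (addL (scale x ys) (0# ∷ mulL xs ys)) zs
      ≈⟨ mulL-distribʳ (scale x ys) (0# ∷ mulL xs ys) zs ⟩
    addL (mulL (scale x ys) zs) (mulL (0# ∷ mulL xs ys) zs)
      ≈⟨ addL-cong (mulL-scaleˡ x ys zs) (≈-trans (mulL-0∷ˡ (mulL xs ys) zs) (∷-cong refl (mulL-assoc xs ys zs))) ⟩
    addL (scale x (mulL ys zs)) (0# ∷ mulL xs (mulL ys zs)) ∎
    where open ≈-Reasoning

  mulL-constˡ : ∀ a xs → mulL [ a ] xs ≈ scale a xs
  mulL-constˡ a xs = ≈-trans (addL-congˡ (scale a xs) (0∷-≈-[] ≈-refl)) (≈-reflexive (addL-identityʳ _))

  mulL-constʳ : ∀ xs a → mulL xs [ a ] ≈ scale a xs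
  mulL-constʳ xs a = ≈-trans (mulL-comm xs [ a ]) (mulL-constˡ a xs)

  mulL-negateʳ : ∀ xs ys → mulL xs (negate ys) ≈ negate (mulL xs ys)
  mulL-negateʳ xs ys = mulL-scaleʳ (⊖ 1#) xs ys

  mulL-distribˡ-negate : ∀ xs ys zs → mulL xs (addL ys (negate zs)) ≈ addL (mulL xs ys) (negate (mulL xs zs))
  mulL-distribˡ-negate xs ys zs =
    ≈-trans (mulL-distribˡ xs ys (negate zs)) (addL-congˡ (mulL xs ys) (mulL-negateʳ xs zs))

  length-addL : ∀ xs ys → length xs ≤ length ys → length (addL xs ys) ≡ length ys
  length-addL []       ys       _         = refl
  length-addL (x ∷ xs) (y ∷ ys) (s≤s ≤ys) = cong suc (length-addL xs ys ≤ys)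

  addL-++ : ∀ xs ys zs → length xs ≤ length ys → addL xs (ys ++ zs) ≡ addL xs ys ++ zs
  addL-++ []       ys       zs _         = refl
  addL-++ (x ∷ xs) (y ∷ ys) zs (s≤s ≤ys) = cong ((x ⊕ y) ∷_) (addL-++ xs ys zs ≤ys)

  addL-∷ʳ : ∀ xs ys a b → length xs ≡ length ys → addL (xs ∷ʳ a) (ys ∷ʳ b) ≡ addL xs ys ∷ʳ (a ⊕ b)
  addL-∷ʳ []       []       a b _   = refl
  addL-∷ʳ (x ∷ xs) (y ∷ ys) a b len = cong ((x ⊕ y) ∷_) (addL-∷ʳ xs ys a b (ℕ.suc-injective len))

  ∷ʳ-zero : ∀ xs {a} → a ≡ 0# → (xs ∷ʳ a) ≈ xs
  ∷ʳ-zero []       a≡0 = coeffwise λ { zero → a≡0 ; (suc n) → refl }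
  ∷ʳ-zero (x ∷ xs) a≡0 = ∷-cong refl (∷ʳ-zero xs a≡0)

  coeff-∷ʳ-length : ∀ u a → coeff (u ∷ʳ a) (length u) ≡ a
  coeff-∷ʳ-length []      a = refl
  coeff-∷ʳ-length (x ∷ u) a = coeff-∷ʳ-length u a

  ∷ʳ-≉-[] : ∀ u {a} → a ≢ 0# → ¬ ((u ∷ʳ a) ≈ [])
  ∷ʳ-≉-[] u a≢0 u∷ʳa≈[] = a≢0 (trans (sym (coeff-∷ʳ-length u _)) (coeff-≡ u∷ʳa≈[] (length u)))

  ∷ʳ-≈-injective : ∀ u v {a b} → a ≢ 0# → b ≢ 0# → (u ∷ʳ a) ≈ (v ∷ʳ b) → u ≡ v × a ≡ b
  ∷ʳ-≈-injective []      []      _   _   eq = refl , coeff-≡ eq 0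
  ∷ʳ-≈-injective []      (y ∷ v) _   b≢0 eq =
    ⊥-elim (b≢0 (trans (sym (coeff-∷ʳ-length v _)) (sym (coeff-≡ eq (suc (length v))))))
  ∷ʳ-≈-injective (x ∷ u) []      a≢0 _   eq =
    ⊥-elim (a≢0 (trans (sym (coeff-∷ʳ-length u _)) (coeff-≡ eq (suc (length u)))))
  ∷ʳ-≈-injective (x ∷ u) (y ∷ v) a≢0 b≢0 eq =
    Product.map₁ (cong₂ _∷_ (coeff-≡ eq 0)) (∷ʳ-≈-injective u v a≢0 b≢0 (∷-injectiveʳ eq))

  data LeadingView (xs : Pol) : Set where
    zero≈ : xs ≈ [] → LeadingView xs
    lead  : ∀ u a → a ≢ 0# → xs ≈ (u ∷ʳ a) → length u < length xs → LeadingView xs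

  leadingView : ∀ xs → LeadingView xs
  leadingView []       = zero≈ ≈-refl
  leadingView (x ∷ xs) with leadingView xs
  ... | lead u a a≢0 xs≈ u<xs = lead (x ∷ u) a a≢0 (∷-cong refl xs≈) (s≤s u<xs)
  ... | zero≈ xs≈[] with x Fin.≟ 0#
  ...   | yes x≡0 = zero≈ (coeffwise λ { zero → x≡0 ; (suc n) → coeff-≡ xs≈[] n })
  ...   | no  x≢0 = lead [] x x≢0 (∷-cong refl xs≈[]) (s≤s z≤n)

  mulL-∷ʳ-∷ʳ : ∀ u a v b → ∃₂ λ w c →
    mulL (u ∷ʳ a) (v ∷ʳ b) ≡ w ∷ʳ c × c ≡ a ⊗ b × length w ≡ length u + length v
  mulL-∷ʳ-∷ʳ []      a []      b = [] , (a ⊗ b) ⊕ 0# , refl , +-identityʳ _ , refl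
  mulL-∷ʳ-∷ʳ []      a (y ∷ v) b = ((a ⊗ y) ⊕ 0#) ∷ scale a v , a ⊗ b ,
    cong (((a ⊗ y) ⊕ 0#) ∷_) (trans (addL-identityʳ _) (List.map-++ (a ⊗_) v [ b ])) ,
    refl , cong suc (List.length-map _ v)
  mulL-∷ʳ-∷ʳ (x ∷ u) a v b with mulL-∷ʳ-∷ʳ u a v b
  ... | w , c , uv≡wc , c≡ab , len-w = addL xv (0# ∷ w) , c , product , c≡ab , length-product
    where
    xv = scale x (v ∷ʳ b)
    length-xv : length xv ≡ suc (length v)
    length-xv = trans (List.length-map _ (v ∷ʳ b)) (trans (List.length-++ v) (ℕ.+-comm (length v) 1))
    xv≤0w : length xv ≤ length (0# ∷ w)
    xv≤0w = ℕ.≤-trans (ℕ.≤-reflexive length-xv) (s≤s (ℕ.≤-trans (ℕ.m≤n+m _ (length u)) (ℕ.≤-reflexive (sym len-w))))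
    product : addL xv (0# ∷ mulL (u ∷ʳ a) (v ∷ʳ b)) ≡ addL xv (0# ∷ w) ∷ʳ c
    product = trans (cong (λ p → addL xv (0# ∷ p)) uv≡wc) (addL-++ xv (0# ∷ w) [ c ] xv≤0w)
    length-product : length (addL xv (0# ∷ w)) ≡ suc (length u + length v)
    length-product = trans (length-addL xv (0# ∷ w) xv≤0w) (cong suc len-w)

  mulL-≈-[] : ∀ {xs ys} → mulL xs ys ≈ [] → xs ≈ [] ⊎ ys ≈ []
  mulL-≈-[] {xs} {ys} xy≈[] with leadingView xs | leadingView ys
  ... | zero≈ xs≈[]         | _                   = inj₁ xs≈[]
  ... | lead _ _ _ _ _      | zero≈ ys≈[]         = inj₂ ys≈[]
  ... | lead u a a≢0 xs≈ _  | lead v b b≢0 ys≈ _  with mulL-∷ʳ-∷ʳ u a v b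
  ...   | w , c , uv≡wc , c≡ab , _ = ⊥-elim (∷ʳ-≉-[] w (λ c≡0 → ⊗-nonZero a≢0 b≢0 (trans (sym c≡ab) c≡0))
            (≈-trans (≈-reflexive (sym uv≡wc)) (≈-trans (mulL-cong (≈-sym xs≈) (≈-sym ys≈)) xy≈[])))

  -- a monic polynomial is stored as the list of its coefficients below the leading 1
  Monic : Set
  Monic = List (Fin q)

  ⟦_⟧ : Monic → Pol
  ⟦ u ⟧ = u ∷ʳ 1#

  ⟦⟧-injective : ∀ {u v} → ⟦ u ⟧ ≈ ⟦ v ⟧ → u ≡ v
  ⟦⟧-injective {u} {v} eq = proj₁ (∷ʳ-≈-injective u v 1≢0 1≢0 eq)

  ⟦⟧-≉-[] : ∀ u → ¬ (⟦ u ⟧ ≈ [])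
  ⟦⟧-≉-[] u = ∷ʳ-≉-[] u 1≢0

  infixl 7 _·_
  _·_ : Monic → Monic → Monic
  u · v = proj₁ (mulL-∷ʳ-∷ʳ u 1# v 1#)

  mulL-⟦⟧ : ∀ u v → mulL ⟦ u ⟧ ⟦ v ⟧ ≡ ⟦ u · v ⟧
  mulL-⟦⟧ u v with mulL-∷ʳ-∷ʳ u 1# v 1#
  ... | w , c , uv≡wc , c≡1⊗1 , _ = trans uv≡wc (cong (w ∷ʳ_) (trans c≡1⊗1 (*-identityˡ 1#)))

  ⟦·⟧ : ∀ u v → ⟦ u · v ⟧ ≈ mulL ⟦ u ⟧ ⟦ v ⟧
  ⟦·⟧ u v = ≈-reflexive (sym (mulL-⟦⟧ u v))

  length-· : ∀ u v → length (u · v) ≡ length u + length v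
  length-· u v = proj₂ (proj₂ (proj₂ (proj₂ (mulL-∷ʳ-∷ʳ u 1# v 1#))))

  length-<-· : ∀ u v → 1 ≤ length v → length u < length (u · v)
  length-<-· u v 1≤v = subst (length u <_) (sym (length-· u v)) (ℕ.m<m+n (length u) 1≤v)

  ·-comm : ∀ u v → u · v ≡ v · u
  ·-comm u v = ⟦⟧-injective (≈-trans (⟦·⟧ u v) (≈-trans (mulL-comm ⟦ u ⟧ ⟦ v ⟧) (≈-sym (⟦·⟧ v u))))

  ·-assoc : ∀ u v w → (u · v) · w ≡ u · (v · w)
  ·-assoc u v w = ⟦⟧-injective (begin
    ⟦ (u · v) · w ⟧                  ≈⟨ ⟦·⟧ (u · v) w ⟩
    mulL ⟦ u · v ⟧ ⟦ w ⟧             ≈⟨ mulL-congˡ ⟦ w ⟧ (⟦·⟧ u v) ⟩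
    mulL (mulL ⟦ u ⟧ ⟦ v ⟧) ⟦ w ⟧    ≈⟨ mulL-assoc ⟦ u ⟧ ⟦ v ⟧ ⟦ w ⟧ ⟩
    mulL ⟦ u ⟧ (mulL ⟦ v ⟧ ⟦ w ⟧)    ≈⟨ mulL-congʳ ⟦ u ⟧ (⟦·⟧ v w) ⟨
    mulL ⟦ u ⟧ ⟦ v · w ⟧             ≈⟨ ⟦·⟧ u (v · w) ⟨
    ⟦ u · (v · w) ⟧                  ∎)
    where open ≈-Reasoning

  ·-identityˡ : ∀ u → [] · u ≡ u
  ·-identityˡ u = ⟦⟧-injective (≈-trans (⟦·⟧ [] u) (≈-trans (mulL-constˡ 1# ⟦ u ⟧) (scale-one ⟦ u ⟧)))

  ·-identityʳ : ∀ u → u · [] ≡ u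
  ·-identityʳ u = trans (·-comm u []) (·-identityˡ u)

  ·-cancelˡ : ∀ u {v w} → u · v ≡ u · w → v ≡ w
  ·-cancelˡ u {v} {w} uv≡uw with mulL-≈-[] u·[v-w]≈[]
    where
    u·[v-w]≈[] : mulL ⟦ u ⟧ (addL ⟦ v ⟧ (negate ⟦ w ⟧)) ≈ []
    u·[v-w]≈[] = begin
      mulL ⟦ u ⟧ (addL ⟦ v ⟧ (negate ⟦ w ⟧))                   ≈⟨ mulL-distribˡ-negate ⟦ u ⟧ ⟦ v ⟧ ⟦ w ⟧ ⟩
      addL (mulL ⟦ u ⟧ ⟦ v ⟧) (negate (mulL ⟦ u ⟧ ⟦ w ⟧))      ≡⟨ cong₂ (λ x y → addL x (negate y)) (mulL-⟦⟧ u v) (mulL-⟦⟧ u w) ⟩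
      addL ⟦ u · v ⟧ (negate ⟦ u · w ⟧)                       ≡⟨ cong (λ x → addL ⟦ x ⟧ (negate ⟦ u · w ⟧)) uv≡uw ⟩
      addL ⟦ u · w ⟧ (negate ⟦ u · w ⟧)                       ≈⟨ addL-negateʳ ⟦ u · w ⟧ ⟩
      []                                                      ∎
      where open ≈-Reasoning
  ... | inj₁ u≈[]   = ⊥-elim (⟦⟧-≉-[] u u≈[])
  ... | inj₂ v-w≈[] = ⟦⟧-injective (addL-negate-≈[] v-w≈[])

  ·-interchange : ∀ a b c d → (a · b) · (c · d) ≡ (a · c) · (b · d)
  ·-interchange a b c d = begin
    (a · b) · (c · d)   ≡⟨ ·-assoc a b (c · d) ⟩
    a · (b · (c · d))   ≡⟨ cong (a ·_) (·-assoc b c d) ⟨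
    a · ((b · c) · d)   ≡⟨ cong (λ x → a · (x · d)) (·-comm b c) ⟩
    a · ((c · b) · d)   ≡⟨ cong (a ·_) (·-assoc c b d) ⟩
    a · (c · (b · d))   ≡⟨ ·-assoc a c (b · d) ⟨
    (a · c) · (b · d)   ∎
    where open ≡-Reasoning

  -- Division with remainder and Euclid's lemma

  -- subtracting c v clears the leading coefficient c of a polynomial of the same degree as ⟦ v ⟧
  ∷ʳ-reduce : ∀ R₀ c v → length R₀ ≡ length v →
    let R = addL R₀ (scale (⊖ c) v) in (R₀ ∷ʳ c) ≈ addL (scale c ⟦ v ⟧) R × length R ≡ length v
  ∷ʳ-reduce R₀ c v R₀≡v = ≈-sym (begin
      addL (scale c V) R                                    ≈⟨ addL-congˡ (scale c V) R≈ ⟩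
      addL (scale c V) (addL X (scale (⊖ c) V))             ≈⟨ addL-assoc (scale c V) X (scale (⊖ c) V) ⟨
      addL (addL (scale c V) X) (scale (⊖ c) V)             ≈⟨ addL-cong (addL-comm (scale c V) X) ≈-refl ⟩
      addL (addL X (scale c V)) (scale (⊖ c) V)             ≈⟨ addL-assoc X (scale c V) (scale (⊖ c) V) ⟩
      addL X (addL (scale c V) (scale (⊖ c) V))             ≈⟨ addL-congˡ X (addL-scale c (⊖ c) V) ⟩
      addL X (scale (c ⊕ (⊖ c)) V)                          ≈⟨ addL-zeroʳ (≈-trans (scale-cong (-‿inverseʳ c) ≈-refl) (scale-zero V)) ⟩
      X                                                     ∎) ,
    trans (length-addL R₀ _ (ℕ.≤-reflexive (trans R₀≡v (sym length-cv)))) length-cv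
    where
    open ≈-Reasoning
    V = ⟦ v ⟧
    X = R₀ ∷ʳ c
    R = addL R₀ (scale (⊖ c) v)
    length-cv : length (scale (⊖ c) v) ≡ length v
    length-cv = List.length-map _ v
    R≈ : R ≈ addL X (scale (⊖ c) V)
    R≈ = ≈-sym (begin
      addL X (scale (⊖ c) V)                            ≡⟨ cong (addL X) (List.map-++ _ v [ 1# ]) ⟩
      addL (R₀ ∷ʳ c) (scale (⊖ c) v ∷ʳ ((⊖ c) ⊗ 1#))   ≡⟨ addL-∷ʳ R₀ _ c _ (trans R₀≡v (sym length-cv)) ⟩
      R ∷ʳ (c ⊕ ((⊖ c) ⊗ 1#))                           ≈⟨ ∷ʳ-zero R (trans (cong (c ⊕_) (*-identityʳ _)) (-‿inverseʳ c)) ⟩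
      R                                                 ∎)

  divMod : ∀ v xs → ∃₂ λ Q R → xs ≈ addL (mulL ⟦ v ⟧ Q) R × length R ≤ length v
  divMod v []       = [] , [] , ≈-sym (≈-trans (≈-reflexive (addL-identityʳ _)) (mulL-zeroʳ ⟦ v ⟧)) , z≤n
  divMod v (x ∷ xs) with divMod v xs
  ... | Q′ , R′ , xs≈ , R′≤v with suc (length R′) ≤? length v
  ...   | yes xR′≤v = 0# ∷ Q′ , x ∷ R′ , x∷xs≈ , xR′≤v
    where
    x∷xs≈ : (x ∷ xs) ≈ addL (mulL ⟦ v ⟧ (0# ∷ Q′)) (x ∷ R′)
    x∷xs≈ = ≈-trans (∷-cong (sym (+-identityˡ x)) xs≈) (addL-cong (≈-sym (mulL-0∷ʳ ⟦ v ⟧ Q′)) ≈-refl)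
  ...   | no  xR′≰v with ∷ʳ-split (x ∷ R′) (s≤s z≤n)
  ...     | R₀ , c , xR′≡R₀c = Q , R , x∷xs≈ , ℕ.≤-reflexive (proj₂ reduced)
    where
    V = ⟦ v ⟧
    Q = addL (0# ∷ Q′) [ c ]
    R = addL R₀ (scale (⊖ c) v)
    length-R₀ : length R₀ ≡ length v
    length-R₀ = ℕ.suc-injective (begin
      suc (length R₀)        ≡⟨ ℕ.+-comm 1 (length R₀) ⟩
      length R₀ + 1          ≡⟨ List.length-++ R₀ ⟨
      length (R₀ ∷ʳ c)       ≡⟨ cong length xR′≡R₀c ⟨
      suc (length R′)        ≡⟨ cong suc (ℕ.≤-antisym R′≤v (ℕ.≮⇒≥ xR′≰v)) ⟩
      suc (length v)         ∎)
      where open ≡-Reasoning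
    reduced = ∷ʳ-reduce R₀ c v length-R₀
    x∷xs≈ : (x ∷ xs) ≈ addL (mulL V Q) R
    x∷xs≈ = begin
      x ∷ xs                                             ≈⟨ ∷-cong (sym (+-identityˡ x)) xs≈ ⟩
      addL (0# ∷ mulL V Q′) (x ∷ R′)                     ≡⟨ cong (addL (0# ∷ mulL V Q′)) xR′≡R₀c ⟩
      addL (0# ∷ mulL V Q′) (R₀ ∷ʳ c)                    ≈⟨ addL-cong (≈-sym (mulL-0∷ʳ V Q′)) (proj₁ reduced) ⟩
      addL (mulL V (0# ∷ Q′)) (addL (scale c V) R)       ≈⟨ addL-assoc (mulL V (0# ∷ Q′)) (scale c V) R ⟨
      addL (addL (mulL V (0# ∷ Q′)) (scale c V)) R       ≈⟨ addL-cong (addL-congˡ (mulL V (0# ∷ Q′)) (≈-sym (mulL-constʳ V c))) ≈-refl ⟩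
      addL (addL (mulL V (0# ∷ Q′)) (mulL V [ c ])) R    ≈⟨ addL-cong (mulL-distribˡ V (0# ∷ Q′) [ c ]) ≈-refl ⟨
      addL (mulL V Q) R                                  ∎
      where open ≈-Reasoning

  infix 4 _∣_ _∣ᴾ_
  record _∣_ (u w : Monic) : Set where
    constructor divides
    field
      quotient : Monic
      equality : u · quotient ≡ w
  open _∣_

  record _∣ᴾ_ (s : Monic) (p : Pol) : Set where
    constructor dividesᴾ
    field
      cofactor : Pol
      cofactor-≈ : p ≈ mulL ⟦ s ⟧ cofactor

  ∣ᴾ⇒∣ : ∀ s x → s ∣ᴾ ⟦ x ⟧ → s ∣ x
  ∣ᴾ⇒∣ s x (dividesᴾ t x≈st) with leadingView t
  ... | zero≈ t≈[] = ⊥-elim (⟦⟧-≉-[] x (≈-trans x≈st (≈-trans (mulL-congʳ ⟦ s ⟧ t≈[]) (mulL-zeroʳ ⟦ s ⟧))))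
  ... | lead t₀ β β≢0 t≈ _ with mulL-∷ʳ-∷ʳ s 1# t₀ β
  ...   | w , c , st≡wc , c≡1β , _ = divides t₀ (⟦⟧-injective (begin
    ⟦ s · t₀ ⟧              ≈⟨ ⟦·⟧ s t₀ ⟩
    mulL ⟦ s ⟧ ⟦ t₀ ⟧       ≡⟨ cong (λ b → mulL ⟦ s ⟧ (t₀ ∷ʳ b)) β≡1 ⟨
    mulL ⟦ s ⟧ (t₀ ∷ʳ β)    ≈⟨ mulL-congʳ ⟦ s ⟧ t≈ ⟨
    mulL ⟦ s ⟧ t            ≈⟨ x≈st ⟨
    ⟦ x ⟧                   ∎))
    where
    open ≈-Reasoning
    c≡β : c ≡ β
    c≡β = trans c≡1β (*-identityˡ β)
    1≡c : 1# ≡ c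
    1≡c = proj₂ (∷ʳ-≈-injective x w 1≢0 (λ c≡0 → β≢0 (trans (sym c≡β) c≡0))
                  (≈-trans x≈st (≈-trans (mulL-congʳ ⟦ s ⟧ t≈) (≈-reflexive st≡wc))))
    β≡1 : β ≡ 1#
    β≡1 = sym (trans 1≡c c≡β)

  ∣ᴾ-mulL : ∀ s t → s ∣ᴾ mulL ⟦ s ⟧ t
  ∣ᴾ-mulL s t = dividesᴾ t ≈-refl

  IsIrreducible : Monic → Set
  IsIrreducible s = 1 ≤ length s × (∀ u v → 1 ≤ length u → 1 ≤ length v → u · v ≢ s)

  irreducible-∤-proper : ∀ {s u} → IsIrreducible s → u ∣ s → 1 ≤ length u → length u < length s → ⊥
  irreducible-∤-proper {u = u} _ (divides [] u·[]≡s) _ u<s =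
    ℕ.<-irrefl (trans (sym (ℕ.+-identityʳ _)) (trans (sym (length-· u [])) (cong length u·[]≡s))) u<s
  irreducible-∤-proper {u = u} (_ , no-factors) (divides (t ∷ ts) ut≡s) 1≤u _ =
    no-factors u (t ∷ ts) 1≤u (s≤s z≤n) ut≡s

  ∣ᴾ-resp-≈ : ∀ {s p p′} → p ≈ p′ → s ∣ᴾ p → s ∣ᴾ p′
  ∣ᴾ-resp-≈ p≈p′ (dividesᴾ t p≈st) = dividesᴾ t (≈-trans (≈-sym p≈p′) p≈st)

  ∣ᴾ-mulL-assoc : ∀ s a b c → s ∣ᴾ mulL a c → s ∣ᴾ mulL (mulL a b) c
  ∣ᴾ-mulL-assoc s a b c (dividesᴾ t ac≈st) = dividesᴾ (mulL b t) (begin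
    mulL (mulL a b) c       ≈⟨ mulL-congˡ c (mulL-comm a b) ⟩
    mulL (mulL b a) c       ≈⟨ mulL-assoc b a c ⟩
    mulL b (mulL a c)       ≈⟨ mulL-congʳ b ac≈st ⟩
    mulL b (mulL ⟦ s ⟧ t)   ≈⟨ mulL-assoc b ⟦ s ⟧ t ⟨
    mulL (mulL b ⟦ s ⟧) t   ≈⟨ mulL-congˡ t (mulL-comm b ⟦ s ⟧) ⟩
    mulL (mulL ⟦ s ⟧ b) t   ≈⟨ mulL-assoc ⟦ s ⟧ b t ⟩
    mulL ⟦ s ⟧ (mulL b t)   ∎)
    where open ≈-Reasoning

  ∣ᴾ-addL-cancelˡ : ∀ s x r b → s ∣ᴾ mulL (addL x r) b → s ∣ᴾ mulL x b → s ∣ᴾ mulL r b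
  ∣ᴾ-addL-cancelˡ s x r b (dividesᴾ t [x+r]b≈st) (dividesᴾ u xb≈su) = dividesᴾ (addL t (negate u)) (begin
    mulL r b                                          ≈⟨ addL-moveˡ (mulL x b) (mulL r b) _ (≈-sym (mulL-distribʳ x r b)) ⟩
    addL (mulL (addL x r) b) (negate (mulL x b))      ≈⟨ addL-cong [x+r]b≈st (scale-cong refl xb≈su) ⟩
    addL (mulL ⟦ s ⟧ t) (negate (mulL ⟦ s ⟧ u))       ≈⟨ mulL-distribˡ-negate ⟦ s ⟧ t u ⟨
    mulL ⟦ s ⟧ (addL t (negate u))                    ∎)
    where open ≈-Reasoning

  ∣ᴾ-scale : ∀ {s p} c → s ∣ᴾ p → s ∣ᴾ scale c p
  ∣ᴾ-scale {s} c (dividesᴾ t p≈st) = dividesᴾ (scale c t) (≈-trans (scale-cong refl p≈st) (≈-sym (mulL-scaleʳ c ⟦ s ⟧ t)))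

  ∣ᴾ-normalise : ∀ s u ρ (ρ≢0 : ρ ≢ 0#) b → s ∣ᴾ mulL (u ∷ʳ ρ) b → s ∣ᴾ mulL ⟦ scale (inv ρ ρ≢0) u ⟧ b
  ∣ᴾ-normalise s u ρ ρ≢0 b s∣ub = ∣ᴾ-resp-≈ ρ⁻¹ub≈ (∣ᴾ-scale ρ⁻¹ s∣ub)
    where
    ρ⁻¹ = inv ρ ρ≢0
    ρ⁻¹ub≈ : scale ρ⁻¹ (mulL (u ∷ʳ ρ) b) ≈ mulL ⟦ scale ρ⁻¹ u ⟧ b
    ρ⁻¹ub≈ = ≈-trans (≈-sym (mulL-scaleˡ ρ⁻¹ (u ∷ʳ ρ) b))
               (≈-reflexive (cong (λ p → mulL p b)
                 (trans (List.map-++ (ρ⁻¹ ⊗_) u [ ρ ]) (cong (scale ρ⁻¹ u ∷ʳ_) (inv-inverseˡ ρ ρ≢0)))))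

  -- descent on deg a: replace a by the remainder of s modulo a
  euclid-lowDegree : ∀ s → IsIrreducible s → ∀ n a → length a < length s → length a ≤ n →
    ∀ b → s ∣ᴾ mulL ⟦ a ⟧ b → s ∣ᴾ b
  euclid-lowDegree s irr n       []      _   _   b s∣b =
    ∣ᴾ-resp-≈ (≈-trans (mulL-constˡ 1# b) (scale-one b)) s∣b
  euclid-lowDegree s irr zero    (y ∷ a) _   ()
  euclid-lowDegree s irr (suc n) (y ∷ a) a<s a≤n b s∣ab with divMod (y ∷ a) ⟦ s ⟧
  ... | Q , R , s≈aQ+R , R≤a with leadingView R
  ...   | zero≈ R≈[] = ⊥-elim (irreducible-∤-proper irr a∣s (s≤s z≤n) a<s)
    where
    a∣s : (y ∷ a) ∣ s
    a∣s = ∣ᴾ⇒∣ (y ∷ a) s (dividesᴾ Q (≈-trans s≈aQ+R (addL-zeroʳ R≈[])))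
  ...   | lead R₀ ρ ρ≢0 R≈ R₀<R =
    euclid-lowDegree s irr n (scale (inv ρ ρ≢0) R₀) R₁<s R₁≤n b
      (∣ᴾ-normalise s R₀ ρ ρ≢0 b (∣ᴾ-resp-≈ (mulL-congˡ b R≈) s∣Rb))
    where
    s∣Rb : s ∣ᴾ mulL R b
    s∣Rb = ∣ᴾ-addL-cancelˡ s (mulL ⟦ y ∷ a ⟧ Q) R b
             (∣ᴾ-resp-≈ (mulL-congˡ b s≈aQ+R) (dividesᴾ b ≈-refl))
             (∣ᴾ-mulL-assoc s ⟦ y ∷ a ⟧ Q b s∣ab)
    length-R₁ : length (scale (inv ρ ρ≢0) R₀) ≡ length R₀
    length-R₁ = List.length-map _ R₀
    R₁<a : length (scale (inv ρ ρ≢0) R₀) < length (y ∷ a)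
    R₁<a = ℕ.<-≤-trans (subst (_< length R) (sym length-R₁) R₀<R) R≤a
    R₁<s = ℕ.<-trans R₁<a a<s
    R₁≤n = ℕ.≤-trans (ℕ.≤-pred R₁<a) (ℕ.≤-pred a≤n)

  irreducible-prime : ∀ {s} → IsIrreducible s → ∀ x y → s ∣ x · y → s ∣ x ⊎ s ∣ y
  irreducible-prime {s} irr x y (divides t st≡xy) with divMod s ⟦ x ⟧
  ... | Q , R , x≈sQ+R , R≤s with leadingView R
  ...   | zero≈ R≈[] = inj₁ (∣ᴾ⇒∣ s x (dividesᴾ Q (≈-trans x≈sQ+R (addL-zeroʳ R≈[]))))
  ...   | lead R₀ ρ ρ≢0 R≈ R₀<R =
    inj₂ (∣ᴾ⇒∣ s y (euclid-lowDegree s irr _ R₁ R₁<s ℕ.≤-refl ⟦ y ⟧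
                      (∣ᴾ-normalise s R₀ ρ ρ≢0 ⟦ y ⟧ (∣ᴾ-resp-≈ (mulL-congˡ ⟦ y ⟧ R≈) s∣Ry))))
    where
    R₁ = scale (inv ρ ρ≢0) R₀
    R₁<s : length R₁ < length s
    R₁<s = ℕ.<-≤-trans (subst (_< length R) (sym (List.length-map _ R₀)) R₀<R) R≤s
    s∣xy : s ∣ᴾ mulL ⟦ x ⟧ ⟦ y ⟧
    s∣xy = dividesᴾ ⟦ t ⟧ (≈-trans (≈-reflexive (trans (mulL-⟦⟧ x y) (cong ⟦_⟧ (sym st≡xy)))) (⟦·⟧ s t))
    s∣Ry : s ∣ᴾ mulL R ⟦ y ⟧
    s∣Ry = ∣ᴾ-addL-cancelˡ s (mulL ⟦ s ⟧ Q) R ⟦ y ⟧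
             (∣ᴾ-resp-≈ (mulL-congˡ ⟦ y ⟧ x≈sQ+R) s∣xy)
             (∣ᴾ-mulL-assoc s ⟦ s ⟧ Q ⟦ y ⟧ (∣ᴾ-mulL s ⟦ y ⟧))

  monics : ℕ → List Monic
  monics zero    = [ [] ]
  monics (suc k) = concatMap (λ a → map (a ∷_) (monics k)) (allFin q)

  ∈-monics : ∀ u → u ∈ monics (length u)
  ∈-monics []      = here refl
  ∈-monics (a ∷ u) = ∈-concatMap⁺ (λ b → map (b ∷_) (monics (length u))) (Any.map (λ { refl → ∈-map⁺ (a ∷_) (∈-monics u) }) (∈-allFin a))

  module _ {P : Monic → Set} (P? : Decidable P) where

    ∃-ofLength? : ∀ k → Dec (∃ λ u → length u ≡ k × P u)
    ∃-ofLength? k = Dec.map′ Any.satisfied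
                             (λ { (u , refl , Pu) → lose (∈-monics u) (refl , Pu) })
                             (any? (λ u → length u ℕ.≟ k ×-dec P? u) (monics k))

    ∃-shorter? : ∀ B → Dec (∃ λ u → length u < B × P u)
    ∃-shorter? B = Dec.map′ (λ { (k , k<B , u , refl , Pu) → u , k<B , Pu })
                            (λ { (u , u<B , Pu) → length u , u<B , u , refl , Pu })
                            (ℕ.anyUpTo? ∃-ofLength? B)

  length-∣ : ∀ {u w} → u ∣ w → length u ≤ length w
  length-∣ {u} {w} (divides t ut≡w) =
    subst (length u ≤_) (trans (sym (length-· u t)) (cong length ut≡w)) (ℕ.m≤m+n _ _)

  infix 4 _∣?_
  _∣?_ : ∀ u w → Dec (u ∣ w)
  u ∣? w = Dec.map′ (λ (t , _ , ut≡w) → divides t ut≡w)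
                    (λ (divides t ut≡w) → t , length-quotient t ut≡w , ut≡w)
                    (∃-ofLength? (λ t → List.≡-dec Fin._≟_ (u · t) w) (length w ∸ length u))
    where
    length-quotient : ∀ t → u · t ≡ w → length t ≡ length w ∸ length u
    length-quotient t ut≡w = sym (begin
      length w ∸ length u              ≡⟨ cong (λ v → length v ∸ length u) ut≡w ⟨
      length (u · t) ∸ length u        ≡⟨ cong (_∸ length u) (length-· u t) ⟩
      length u + length t ∸ length u   ≡⟨ ℕ.m+n∸m≡n (length u) (length t) ⟩
      length t ∎)
      where open ≡-Reasoning

  ∣-refl : ∀ u → u ∣ u
  ∣-refl u = divides [] (·-identityʳ u)

  []∣ : ∀ u → [] ∣ u
  []∣ u = divides u (·-identityˡ u)

  ∣-trans : ∀ {u v w} → u ∣ v → v ∣ w → u ∣ w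
  ∣-trans {u} (divides t ut≡v) (divides t′ vt′≡w) =
    divides (t · t′) (trans (sym (·-assoc u t t′)) (trans (cong (_· t′) ut≡v) vt′≡w))

  u∣u·v : ∀ u v → u ∣ u · v
  u∣u·v u v = divides v refl

  ∣u⇒∣u·v : ∀ {w u} v → w ∣ u → w ∣ u · v
  ∣u⇒∣u·v v w∣u = ∣-trans w∣u (u∣u·v _ v)

  ∣v⇒∣u·v : ∀ {w v} u → w ∣ v → w ∣ u · v
  ∣v⇒∣u·v {v = v} u w∣v = subst (_ ∣_) (·-comm v u) (∣u⇒∣u·v u w∣v)

  ·-monoʳ-∣ : ∀ x {u v} → u ∣ v → x · u ∣ x · v
  ·-monoʳ-∣ x {u} (divides t ut≡v) = divides t (trans (·-assoc x u t) (cong (x ·_) ut≡v))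

  ·-cancelˡ-∣ : ∀ x {u v} → x · u ∣ x · v → u ∣ v
  ·-cancelˡ-∣ x {u} (divides t xut≡xv) = divides t (·-cancelˡ x (trans (sym (·-assoc x u t)) xut≡xv))

  infixr 8 _^ᴹ_
  _^ᴹ_ : Monic → ℕ → Monic
  u ^ᴹ zero  = []
  u ^ᴹ suc e = u · u ^ᴹ e

  powL-⟦⟧ : ∀ u e → powL ⟦ u ⟧ e ≡ ⟦ u ^ᴹ e ⟧
  powL-⟦⟧ u zero    = refl
  powL-⟦⟧ u (suc e) = trans (cong (mulL ⟦ u ⟧) (powL-⟦⟧ u e)) (mulL-⟦⟧ u (u ^ᴹ e))

  length-^ᴹ : ∀ u e → length (u ^ᴹ e) ≡ e * length u
  length-^ᴹ u zero    = refl
  length-^ᴹ u (suc e) = trans (length-· u (u ^ᴹ e)) (cong (length u +_) (length-^ᴹ u e))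

  []^ᴹ : ∀ e → [] ^ᴹ e ≡ []
  []^ᴹ zero    = refl
  []^ᴹ (suc e) = trans (·-identityˡ _) ([]^ᴹ e)

  ^ᴹ-distribˡ-+ : ∀ u a b → u ^ᴹ (a + b) ≡ u ^ᴹ a · u ^ᴹ b
  ^ᴹ-distribˡ-+ u zero    b = sym (·-identityˡ _)
  ^ᴹ-distribˡ-+ u (suc a) b = trans (cong (u ·_) (^ᴹ-distribˡ-+ u a b)) (sym (·-assoc u _ _))

  ^ᴹ-distribʳ-· : ∀ u v e → (u · v) ^ᴹ e ≡ u ^ᴹ e · v ^ᴹ e
  ^ᴹ-distribʳ-· u v zero    = sym (·-identityˡ [])
  ^ᴹ-distribʳ-· u v (suc e) = trans (cong ((u · v) ·_) (^ᴹ-distribʳ-· u v e)) (·-interchange u v _ _)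

  ^ᴹ-*-assoc : ∀ u a b → (u ^ᴹ a) ^ᴹ b ≡ u ^ᴹ (b * a)
  ^ᴹ-*-assoc u a zero    = refl
  ^ᴹ-*-assoc u a (suc b) = trans (cong (u ^ᴹ a ·_) (^ᴹ-*-assoc u a b)) (sym (^ᴹ-distribˡ-+ u a (b * a)))

  ^ᴹ-monoˡ-∣ : ∀ {u v} e → u ∣ v → u ^ᴹ e ∣ v ^ᴹ e
  ^ᴹ-monoˡ-∣ {u} e (divides t refl) = divides (t ^ᴹ e) (sym (^ᴹ-distribʳ-· u t e))

  ^ᴹ-monoʳ-∣ : ∀ u {a b} → a ≤ b → u ^ᴹ a ∣ u ^ᴹ b
  ^ᴹ-monoʳ-∣ u {a} {b} a≤b =
    divides (u ^ᴹ (b ∸ a)) (trans (sym (^ᴹ-distribˡ-+ u a (b ∸ a))) (cong (u ^ᴹ_) (ℕ.m+[n∸m]≡n a≤b)))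

  ∣u^ᴹ : ∀ u e → 1 ≤ e → u ∣ u ^ᴹ e
  ∣u^ᴹ u (suc e) _ = u∣u·v u (u ^ᴹ e)

  length-≤-^ᴹ : ∀ c k → 1 ≤ k → length c ≤ length (c ^ᴹ k)
  length-≤-^ᴹ c k 1≤k = length-∣ (∣u^ᴹ c k 1≤k)

  irreducibleFactor : ∀ c → 1 ≤ length c → ∃ λ s → IsIrreducible s × s ∣ c
  irreducibleFactor c = go c (<-wellFounded (length c))
    where
    go : ∀ c → Acc _<_ (length c) → 1 ≤ length c → ∃ λ s → IsIrreducible s × s ∣ c
    go c (acc smaller) 1≤c with ∃-shorter? (λ u → (1 ≤? length u) ×-dec (u ∣? c)) (length c)
    ... | yes (u , u<c , 1≤u , u∣c) =
      let s , s-irr , s∣u = go u (smaller u<c) 1≤u in s , s-irr , ∣-trans s∣u u∣c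
    ... | no ∄u = c , (1≤c , c-irr) , ∣-refl c
      where
      c-irr : ∀ u v → 1 ≤ length u → 1 ≤ length v → u · v ≢ c
      c-irr u v 1≤u 1≤v refl = ∄u (u , length-<-· u v 1≤v , 1≤u , u∣u·v u v)

  irreducible-∤[] : ∀ {s} → IsIrreducible s → ¬ (s ∣ [])
  irreducible-∤[] (1≤s , _) s∣[] = ℕ.<-irrefl refl (ℕ.≤-trans 1≤s (length-∣ s∣[]))

  irreducible-∤^ᴹ : ∀ {s} → IsIrreducible s → ∀ {y} → ¬ (s ∣ y) → ∀ e → ¬ (s ∣ y ^ᴹ e)
  irreducible-∤^ᴹ irr s∤y zero    = irreducible-∤[] irr
  irreducible-∤^ᴹ irr {y} s∤y (suc e) s∣yᵉ⁺¹ with irreducible-prime irr y (y ^ᴹ e) s∣yᵉ⁺¹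
  ... | inj₁ s∣y  = s∤y s∣y
  ... | inj₂ s∣yᵉ = irreducible-∤^ᴹ irr s∤y e s∣yᵉ

  ^ᴹ-∣-cancelˡ : ∀ {s} → IsIrreducible s → ∀ {y} → ¬ (s ∣ y) → ∀ j x → s ^ᴹ j ∣ y · x → s ^ᴹ j ∣ x
  ^ᴹ-∣-cancelˡ irr s∤y zero    x _ = []∣ x
  ^ᴹ-∣-cancelˡ {s} irr {y} s∤y (suc j) x sʲ⁺¹∣yx
    with irreducible-prime irr y x (∣-trans (u∣u·v s (s ^ᴹ j)) sʲ⁺¹∣yx)
  ... | inj₁ s∣y = ⊥-elim (s∤y s∣y)
  ... | inj₂ (divides x′ refl) =
    ·-monoʳ-∣ s (^ᴹ-∣-cancelˡ irr s∤y j x′ (·-cancelˡ-∣ s (subst (s · s ^ᴹ j ∣_) y·sx′≡s·yx′ sʲ⁺¹∣yx)))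
    where
    y·sx′≡s·yx′ : y · (s · x′) ≡ s · (y · x′)
    y·sx′≡s·yx′ = trans (sym (·-assoc y s x′)) (trans (cong (_· x′) (·-comm y s)) (·-assoc s y x′))

  splitOff : ∀ {s} → IsIrreducible s → ∀ c → ∃₂ λ v c₀ → c ≡ s ^ᴹ v · c₀ × ¬ (s ∣ c₀)
  splitOff {s} irr c = go c (<-wellFounded (length c))
    where
    go : ∀ c → Acc _<_ (length c) → ∃₂ λ v c₀ → c ≡ s ^ᴹ v · c₀ × ¬ (s ∣ c₀)
    go c (acc smaller) with s ∣? c
    ... | no  s∤c = 0 , c , sym (·-identityˡ c) , s∤c
    ... | yes (divides t refl) with go t (smaller (subst (length t <_) (cong length (·-comm t s)) (length-<-· t s (proj₁ irr))))
    ...   | v , c₀ , refl , s∤c₀ = suc v , c₀ , sym (·-assoc s (s ^ᴹ v) c₀) , s∤c₀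

  -- Power-free decomposition of tuples

  MTuple : ℕ → Set
  MTuple d = Fin d → Monic

  infixr 7 _⋆_
  _⋆_ : ∀ {d} → Monic → MTuple d → MTuple d
  (c ⋆ P) i = c · P i

  infix 4 _∣ᵗ_
  _∣ᵗ_ : ∀ {d} → Monic → MTuple d → Set
  u ∣ᵗ P = ∀ i → u ∣ P i

  PowerFree : ∀ {d} → ℕ → MTuple d → Set
  PowerFree k P = ∀ s → IsIrreducible s → ¬ (s ^ᴹ k ∣ᵗ P)

  PowerFree-mono : ∀ {d a b} (P : MTuple d) → a ≤ b → PowerFree a P → PowerFree b P
  PowerFree-mono P a≤b free s irr sᵇ∣P = free s irr (λ i → ∣-trans (^ᴹ-monoʳ-∣ s a≤b) (sᵇ∣P i))

  PowerFree-resp : ∀ {d k} {P Q : MTuple d} → (∀ i → P i ≡ Q i) → PowerFree k P → PowerFree k Q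
  PowerFree-resp {k = k} P≡Q free s irr sᵏ∣Q = free s irr (λ i → subst (s ^ᴹ k ∣_) (sym (P≡Q i)) (sᵏ∣Q i))

  -- any common k-th power divisor may be taken of degree at most deg P₀
  powerDivisor? : ∀ {d} k → 1 ≤ k → (P : MTuple (suc d)) →
    (∃ λ c → 1 ≤ length c × c ^ᴹ k ∣ᵗ P) ⊎ PowerFree k P
  powerDivisor? k 1≤k P
    with ∃-shorter? (λ c → (1 ≤? length c) ×-dec Fin.all? (λ i → c ^ᴹ k ∣? P i)) (suc (length (P Fin.zero)))
  ... | yes (c , _ , 1≤c , cᵏ∣P) = inj₁ (c , 1≤c , cᵏ∣P)
  ... | no ∄c = inj₂ λ s irr sᵏ∣P →
    ∄c (s , s≤s (ℕ.≤-trans (length-≤-^ᴹ s k 1≤k) (length-∣ (sᵏ∣P Fin.zero))) , proj₁ irr , sᵏ∣P)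

  powerFree? : ∀ {d} k → 1 ≤ k → (P : MTuple (suc d)) → Dec (PowerFree k P)
  powerFree? k 1≤k P with powerDivisor? k 1≤k P
  ... | inj₂ free = yes free
  ... | inj₁ (c , 1≤c , cᵏ∣P) = no λ free →
    let s , irr , s∣c = irreducibleFactor c 1≤c in free s irr (λ i → ∣-trans (^ᴹ-monoˡ-∣ k s∣c) (cᵏ∣P i))

  record Decomposition {d} (k : ℕ) (P : MTuple d) : Set where
    field
      base               : Monic
      cofactor           : MTuple d
      split              : ∀ i → P i ≡ (base ^ᴹ k ⋆ cofactor) i
      cofactor-powerFree : PowerFree k cofactor
  open Decomposition

  decompose : ∀ {d} k → 1 ≤ k → (P : MTuple (suc d)) → Decomposition k P
  decompose k 1≤k P = go P (<-wellFounded (length (P Fin.zero)))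
    where
    go : ∀ P → Acc _<_ (length (P Fin.zero)) → Decomposition k P
    go P (acc smaller) with powerDivisor? k 1≤k P
    ... | inj₂ free = record { base = [] ; cofactor = P ; cofactor-powerFree = free
                             ; split = λ i → sym (trans (cong (_· P i) ([]^ᴹ k)) (·-identityˡ (P i))) }
    ... | inj₁ (c , 1≤c , cᵏ∣P) = record
      { base = c · base D ; cofactor = cofactor D ; cofactor-powerFree = cofactor-powerFree D
      ; split = λ i → begin
          P i                                       ≡⟨ equality (cᵏ∣P i) ⟨
          c ^ᴹ k · Q i                              ≡⟨ cong (c ^ᴹ k ·_) (split D i) ⟩
          c ^ᴹ k · (base D ^ᴹ k · cofactor D i)     ≡⟨ ·-assoc (c ^ᴹ k) _ _ ⟨
          (c ^ᴹ k · base D ^ᴹ k) · cofactor D i     ≡⟨ cong (_· cofactor D i) (^ᴹ-distribʳ-· c (base D) k) ⟨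
          (c · base D) ^ᴹ k · cofactor D i          ∎ }
      where
      open ≡-Reasoning
      Q : MTuple _
      Q i = quotient (cᵏ∣P i)
      Q₀<P₀ : length (Q Fin.zero) < length (P Fin.zero)
      Q₀<P₀ = subst (length (Q Fin.zero) <_) (cong length (equality (cᵏ∣P Fin.zero)))
                (subst (length (Q Fin.zero) <_) (cong length (·-comm (Q Fin.zero) (c ^ᴹ k)))
                  (length-<-· (Q Fin.zero) (c ^ᴹ k) (ℕ.≤-trans 1≤c (length-≤-^ᴹ c k 1≤k))))
      D = go Q (smaller Q₀<P₀)

  ⋆-cancelˡ : ∀ {d} c {P Q : MTuple d} → (∀ i → (c ⋆ P) i ≡ (c ⋆ Q) i) → ∀ i → P i ≡ Q i
  ⋆-cancelˡ c cP≡cQ i = ·-cancelˡ c (cP≡cQ i)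

  ^ᴹ-·-assoc : ∀ s a k X → (s · a) ^ᴹ k · X ≡ s ^ᴹ k · (a ^ᴹ k · X)
  ^ᴹ-·-assoc s a k X = trans (cong (_· X) (^ᴹ-distribʳ-· s a k)) (·-assoc (s ^ᴹ k) (a ^ᴹ k) X)

  -- compare an irreducible factor s of c with c′: either it cancels, or s^k divides the cofactor of c′
  decomposition-unique : ∀ {d} k {P P′ : MTuple d} → PowerFree k P → PowerFree k P′ →
    ∀ c c′ → (∀ i → (c ^ᴹ k ⋆ P) i ≡ (c′ ^ᴹ k ⋆ P′) i) → c ≡ c′
  decomposition-unique k {P} {P′} free free′ c = go c (<-wellFounded (length c))
    where
    go : ∀ c → Acc _<_ (length c) → ∀ c′ → (∀ i → (c ^ᴹ k ⋆ P) i ≡ (c′ ^ᴹ k ⋆ P′) i) → c ≡ c′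
    go []      _             []        _  = refl
    go []      _             c′@(_ ∷ _) eq with irreducibleFactor c′ (s≤s z≤n)
    ... | s , irr , s∣c′ = ⊥-elim (free s irr λ i →
      subst (s ^ᴹ k ∣_) (trans (sym (eq i)) (trans (cong (_· P i) ([]^ᴹ k)) (·-identityˡ (P i))))
        (∣u⇒∣u·v (P′ i) (^ᴹ-monoˡ-∣ k s∣c′)))
    go c@(_ ∷ _) (acc smaller) c′ eq with irreducibleFactor c (s≤s z≤n)
    ... | s , irr , divides c₁ sc₁≡c with s ∣? c′
    ...   | yes (divides c₁′ sc₁′≡c′) =
      trans (sym sc₁≡c) (trans (cong (s ·_) (go c₁ (smaller c₁<c) c₁′ eq′)) sc₁′≡c′)
      where
      c₁<c : length c₁ < length c
      c₁<c = subst (length c₁ <_) (cong length (trans (·-comm c₁ s) sc₁≡c)) (length-<-· c₁ s (proj₁ irr))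
      eq′ : ∀ i → (c₁ ^ᴹ k ⋆ P) i ≡ (c₁′ ^ᴹ k ⋆ P′) i
      eq′ i = ·-cancelˡ (s ^ᴹ k) (begin
        s ^ᴹ k · (c₁ ^ᴹ k · P i)      ≡⟨ ^ᴹ-·-assoc s c₁ k (P i) ⟨
        (s · c₁) ^ᴹ k · P i           ≡⟨ cong (λ x → x ^ᴹ k · P i) sc₁≡c ⟩
        c ^ᴹ k · P i                  ≡⟨ eq i ⟩
        c′ ^ᴹ k · P′ i                ≡⟨ cong (λ x → x ^ᴹ k · P′ i) sc₁′≡c′ ⟨
        (s · c₁′) ^ᴹ k · P′ i         ≡⟨ ^ᴹ-·-assoc s c₁′ k (P′ i) ⟩
        s ^ᴹ k · (c₁′ ^ᴹ k · P′ i)    ∎)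
        where open ≡-Reasoning
    ...   | no s∤c′ = ⊥-elim (free′ s irr λ i →
      ^ᴹ-∣-cancelˡ irr (irreducible-∤^ᴹ irr s∤c′ k) k (P′ i)
        (subst (s ^ᴹ k ∣_) (eq i) (∣u⇒∣u·v (P i) (^ᴹ-monoˡ-∣ k (divides c₁ sc₁≡c)))))

  decomposition-determined : ∀ {d} k {Q : MTuple d} (D : Decomposition k Q) c {P : MTuple d} →
    PowerFree k P → (∀ i → Q i ≡ (c ^ᴹ k ⋆ P) i) → base D ≡ c × (∀ i → cofactor D i ≡ P i)
  decomposition-determined k D c {P} free Q≡cP = base≡c , ⋆-cancelˡ (c ^ᴹ k) cofactor≡
    where
    base≡c = decomposition-unique k (cofactor-powerFree D) free (base D) c (λ i → trans (sym (split D i)) (Q≡cP i))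
    cofactor≡ : ∀ i → (c ^ᴹ k ⋆ cofactor D) i ≡ (c ^ᴹ k ⋆ P) i
    cofactor≡ i = trans (cong (λ b → b ^ᴹ k · cofactor D i) (sym base≡c)) (trans (sym (split D i)) (Q≡cP i))

  MinMultiplicity : ∀ {d} → MTuple d → Monic → ℕ → Set
  MinMultiplicity P s e = s ^ᴹ e ∣ᵗ P × ∃ λ i → ¬ (s ^ᴹ suc e ∣ P i)

  IsGood : ∀ {d} (r m : ℕ) → .{{_ : NonZero m}} → MTuple d → Set
  IsGood r m P = ∀ s → IsIrreducible s → s ∣ᵗ P → ∀ e → MinMultiplicity P s e → e % m < r

  MinMultiplicity-unique : ∀ {d} {P : MTuple d} {s e₁ e₂} → MinMultiplicity P s e₁ → MinMultiplicity P s e₂ → e₁ ≡ e₂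
  MinMultiplicity-unique {s = s} (sᵉ¹∣P , i₁ , ¬sᵉ¹⁺¹∣P) (sᵉ²∣P , i₂ , ¬sᵉ²⁺¹∣P) with ℕ.<-cmp _ _
  ... | tri≈ _ e₁≡e₂ _ = e₁≡e₂
  ... | tri< e₁<e₂ _ _ = ⊥-elim (¬sᵉ¹⁺¹∣P (∣-trans (^ᴹ-monoʳ-∣ s e₁<e₂) (sᵉ²∣P i₁)))
  ... | tri> _ _ e₂<e₁ = ⊥-elim (¬sᵉ²⁺¹∣P (∣-trans (^ᴹ-monoʳ-∣ s e₂<e₁) (sᵉ¹∣P i₂)))

  _^ᴹ_∣ᵗ?_ : ∀ {d} s j (P : MTuple d) → Dec (s ^ᴹ j ∣ᵗ P)
  s ^ᴹ j ∣ᵗ? P = Fin.all? (λ i → s ^ᴹ j ∣? P i)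

  minMultiplicity-⋆ : ∀ {d} m {s} → IsIrreducible s → ∀ v {c₀} → ¬ (s ∣ c₀) → ∀ j (P : MTuple d) →
    s ^ᴹ j ∣ᵗ P → ¬ (s ^ᴹ suc j ∣ᵗ P) → MinMultiplicity ((s ^ᴹ v · c₀) ^ᴹ m ⋆ P) s (m * v + j)
  minMultiplicity-⋆ {d} m {s} irr v {c₀} s∤c₀ j P sʲ∣P sʲ⁺¹∤P = sᵉ∣cP , i , sᵉ⁺¹∤cPᵢ
    where
    X : MTuple d
    X i = c₀ ^ᴹ m · P i
    cP≡sX : ∀ i → ((s ^ᴹ v · c₀) ^ᴹ m ⋆ P) i ≡ s ^ᴹ (m * v) · X i
    cP≡sX i = trans (^ᴹ-·-assoc (s ^ᴹ v) c₀ m (P i)) (cong (_· X i) (^ᴹ-*-assoc s v m))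
    sᵉ∣cP : s ^ᴹ (m * v + j) ∣ᵗ ((s ^ᴹ v · c₀) ^ᴹ m ⋆ P)
    sᵉ∣cP i = subst₂ _∣_ (sym (^ᴹ-distribˡ-+ s (m * v) j)) (sym (cP≡sX i))
                (·-monoʳ-∣ (s ^ᴹ (m * v)) (∣v⇒∣u·v (c₀ ^ᴹ m) (sʲ∣P i)))
    i = proj₁ (Fin.¬∀⟶∃¬ d _ (λ i → s ^ᴹ suc j ∣? P i) sʲ⁺¹∤P)
    sᵉ⁺¹∤cPᵢ : ¬ (s ^ᴹ suc (m * v + j) ∣ ((s ^ᴹ v · c₀) ^ᴹ m ⋆ P) i)
    sᵉ⁺¹∤cPᵢ sᵉ⁺¹∣cPᵢ = proj₂ (Fin.¬∀⟶∃¬ d _ (λ i → s ^ᴹ suc j ∣? P i) sʲ⁺¹∤P)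
      (^ᴹ-∣-cancelˡ irr (irreducible-∤^ᴹ irr s∤c₀ m) (suc j) (P i)
        (·-cancelˡ-∣ (s ^ᴹ (m * v))
          (subst₂ _∣_ (trans (cong (s ^ᴹ_) (sym (ℕ.+-suc (m * v) j))) (^ᴹ-distribˡ-+ s (m * v) (suc j)))
                      (cP≡sX i) sᵉ⁺¹∣cPᵢ)))

  -- the multiplicity of s in c^m ⋆ P is m v + j with j < m read off from P, so its residue is j
  powerFree⇒good : ∀ {d} r m .{{_ : NonZero m}} → r < m → ∀ c (P : MTuple d) →
    PowerFree r P → IsGood r m (c ^ᴹ m ⋆ P)
  powerFree⇒good r m r<m c P free s irr _ e minMult with splitOff irr c
  ... | v , c₀ , refl , s∤c₀
    with find-drop (λ j → s ^ᴹ j ∣ᵗ? P) r z≤n (λ i → []∣ (P i)) (free s irr)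
  ...   | j , _ , j<r , sʲ∣P , sʲ⁺¹∤P =
    subst (_< r) (sym (trans (cong (_% m) (MinMultiplicity-unique minMult (minMultiplicity-⋆ m irr v s∤c₀ j P sʲ∣P sʲ⁺¹∤P)))
                             ([m*v+j]%m≡j m v j (ℕ.<-trans j<r r<m)))) j<r

  good⇒powerFree : ∀ {d} r m .{{_ : NonZero m}} → r < m → 1 ≤ r → ∀ c (P : MTuple d) →
    PowerFree m P → IsGood r m (c ^ᴹ m ⋆ P) → PowerFree r P
  good⇒powerFree r m r<m 1≤r c P free good s irr sʳ∣P with splitOff irr c
  ... | v , c₀ , refl , s∤c₀
    with find-drop (λ j → s ^ᴹ j ∣ᵗ? P) m (ℕ.<⇒≤ r<m) sʳ∣P (free s irr)
  ...   | j , r≤j , j<m , sʲ∣P , sʲ⁺¹∤P = ℕ.<-irrefl refl (ℕ.<-≤-trans j<r r≤j)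
    where
    minMult = minMultiplicity-⋆ m irr v s∤c₀ j P sʲ∣P sʲ⁺¹∤P
    s∣cP : s ∣ᵗ ((s ^ᴹ v · c₀) ^ᴹ m ⋆ P)
    s∣cP i = ∣-trans (∣u^ᴹ s (m * v + j) (ℕ.≤-trans 1≤r (ℕ.≤-trans r≤j (ℕ.m≤n+m j (m * v))))) (proj₁ minMult i)
    j<r : j < r
    j<r = subst (_< r) ([m*v+j]%m≡j m v j j<m) (good s irr s∣cP (m * v + j) minMult)

  ∣P⇒∣ : ∀ u w → ⟦ u ⟧ ∣P ⟦ w ⟧ → u ∣ w
  ∣P⇒∣ u w (_ , t , ut≡w) = divides (toList t) (⟦⟧-injective (≈-reflexive (trans (sym (mulL-⟦⟧ u (toList t))) ut≡w)))

  ∣⇒∣P : ∀ u w → u ∣ w → ⟦ u ⟧ ∣P ⟦ w ⟧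
  ∣⇒∣P u w (divides t ut≡w) = length t , fromList t ,
    trans (cong (λ t′ → mulL ⟦ u ⟧ ⟦ t′ ⟧) (Vec.toList∘fromList t)) (trans (mulL-⟦⟧ u t) (cong ⟦_⟧ ut≡w))

  ^ᴹ-∣P⇒∣ : ∀ u e w → powL ⟦ u ⟧ e ∣P ⟦ w ⟧ → u ^ᴹ e ∣ w
  ^ᴹ-∣P⇒∣ u e w = ∣P⇒∣ (u ^ᴹ e) w ∘ subst (_∣P ⟦ w ⟧) (powL-⟦⟧ u e)

  ^ᴹ-∣⇒∣P : ∀ u e w → u ^ᴹ e ∣ w → powL ⟦ u ⟧ e ∣P ⟦ w ⟧
  ^ᴹ-∣⇒∣P u e w = subst (_∣P ⟦ w ⟧) (sym (powL-⟦⟧ u e)) ∘ ∣⇒∣P (u ^ᴹ e) w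

  1≤length-toList : ∀ {k} (u : Vec (Fin q) (suc k)) → 1 ≤ length (toList u)
  1≤length-toList (_ Vec.∷ _) = s≤s z≤n

  Irreducible⇒IsIrreducible : ∀ {k} (s : Vec (Fin q) k) → Irreducible s → IsIrreducible (toList s)
  Irreducible⇒IsIrreducible s (1≤k , no-factors) = subst (1 ≤_) (sym (Vec.length-toList s)) 1≤k , no-factors′
    where
    no-factors′ : ∀ u v → 1 ≤ length u → 1 ≤ length v → u · v ≢ toList s
    no-factors′ (x ∷ u) (y ∷ v) _ _ uv≡s = no-factors (length u) (length v) (fromList (x ∷ u)) (fromList (y ∷ v))
      (trans (cong₂ (λ u′ v′ → mulL ⟦ u′ ⟧ ⟦ v′ ⟧) (Vec.toList∘fromList (x ∷ u)) (Vec.toList∘fromList (y ∷ v)))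
             (trans (mulL-⟦⟧ (x ∷ u) (y ∷ v)) (cong ⟦_⟧ uv≡s)))

  IsIrreducible⇒Irreducible : ∀ {k} (s : Vec (Fin q) k) → IsIrreducible (toList s) → Irreducible s
  IsIrreducible⇒Irreducible s (1≤s , no-factors) = subst (1 ≤_) (Vec.length-toList s) 1≤s ,
    λ a b u v uv≡s → no-factors (toList u) (toList v) (1≤length-toList u) (1≤length-toList v)
      (⟦⟧-injective (≈-reflexive (trans (sym (mulL-⟦⟧ (toList u) (toList v))) uv≡s)))

  IsGood-resp : ∀ {d} r m .{{_ : NonZero m}} {P Q : MTuple d} → (∀ i → P i ≡ Q i) → IsGood r m P → IsGood r m Q
  IsGood-resp r m P≡Q good s irr s∣Q e (sᵉ∣Q , i , sᵉ⁺¹∤Qᵢ) =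
    good s irr (λ j → subst (s ∣_) (sym (P≡Q j)) (s∣Q j)) e
      ((λ j → subst (s ^ᴹ e ∣_) (sym (P≡Q j)) (sᵉ∣Q j)) , i , sᵉ⁺¹∤Qᵢ ∘ subst (s ^ᴹ suc e ∣_) (P≡Q i))

  Good⇒IsGood : ∀ {d n} r m .{{_ : NonZero m}} (p : Tuple d n) → Good r m p → IsGood r m (toList ∘ p)
  Good⇒IsGood r m p good s irr s∣p e (sᵉ∣p , i , sᵉ⁺¹∤pᵢ) =
    good (length s) (fromList s) (IsIrreducible⇒Irreducible (fromList s) (subst IsIrreducible (sym s≡) irr))
      (λ j → ∣⇒∣P (toList (fromList s)) _ (subst (_∣ toList (p j)) (sym s≡) (s∣p j))) e
      ((λ j → ^ᴹ-∣⇒∣P (toList (fromList s)) e _ (subst (λ s′ → s′ ^ᴹ e ∣ toList (p j)) (sym s≡) (sᵉ∣p j))) , i ,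
       λ sᵉ⁺¹∣pᵢ → sᵉ⁺¹∤pᵢ (subst (λ s′ → s′ ^ᴹ suc e ∣ toList (p i)) s≡ (^ᴹ-∣P⇒∣ (toList (fromList s)) (suc e) _ sᵉ⁺¹∣pᵢ)))
    where
    s≡ : toList (fromList s) ≡ s
    s≡ = Vec.toList∘fromList s

  IsGood⇒Good : ∀ {d n} r m .{{_ : NonZero m}} (p : Tuple d n) → IsGood r m (toList ∘ p) → Good r m p
  IsGood⇒Good r m p good k s irr s∣p e (sᵉ∣p , i , sᵉ⁺¹∤pᵢ) =
    good (toList s) (Irreducible⇒IsIrreducible s irr) (λ j → ∣P⇒∣ _ _ (s∣p j)) e
      ((λ j → ^ᴹ-∣P⇒∣ (toList s) e _ (sᵉ∣p j)) , i , sᵉ⁺¹∤pᵢ ∘ ^ᴹ-∣⇒∣P (toList s) (suc e) _)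

  -- Counting tuples

  monics-cartesian : ∀ k → monics (suc k) ≡ cartesianProductWith _∷_ (allFin q) (monics k)
  monics-cartesian k = concatMap-map≡cartesianProductWith _∷_ (allFin q) (monics k)

  monics-Unique : ∀ k → Unique (monics k)
  monics-Unique zero    = All.[] ∷ []
  monics-Unique (suc k) = subst Unique (sym (monics-cartesian k))
    (Unique.cartesianProductWith⁺ _∷_ List.∷-injective (Unique.allFin⁺ q) (monics-Unique k))

  length-monics : ∀ k → length (monics k) ≡ q ^ k
  length-monics zero    = refl
  length-monics (suc k) = begin
    length (monics (suc k))                                   ≡⟨ cong length (monics-cartesian k) ⟩
    length (cartesianProductWith _∷_ (allFin q) (monics k))   ≡⟨ length-cartesianProductWith _∷_ (allFin q) (monics k) ⟩
    length (allFin q) * length (monics k)                     ≡⟨ cong₂ _*_ (List.length-tabulate {n = q} id) (length-monics k) ⟩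
    q * q ^ k                                                 ∎
    where open ≡-Reasoning

  ∈-monics⁻ : ∀ k {u} → u ∈ monics k → length u ≡ k
  ∈-monics⁻ zero    (here refl) = refl
  ∈-monics⁻ (suc k) u∈ with ∈-cartesianProductWith⁻ _∷_ (allFin q) (monics k) (subst (_ ∈_) (monics-cartesian k) u∈)
  ... | _ , _ , _ , u∈′ , refl = cong suc (∈-monics⁻ k u∈′)

  tuples : ∀ d → (Fin d → ℕ) → List (Vec Monic d)
  tuples zero    n = [ Vec.[] ]
  tuples (suc d) n = concatMap (λ u → map (u Vec.∷_) (tuples d (n ∘ Fin.suc))) (monics (n Fin.zero))

  tuples-cartesian : ∀ d n → tuples (suc d) n ≡ cartesianProductWith Vec._∷_ (monics (n Fin.zero)) (tuples d (n ∘ Fin.suc))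
  tuples-cartesian d n = concatMap-map≡cartesianProductWith Vec._∷_ (monics (n Fin.zero)) (tuples d (n ∘ Fin.suc))

  tuples-cong : ∀ d {n n′ : Fin d → ℕ} → (∀ i → n i ≡ n′ i) → tuples d n ≡ tuples d n′
  tuples-cong zero    n≡n′ = refl
  tuples-cong (suc d) n≡n′ = cong₂ (λ k vs → concatMap (λ u → map (u Vec.∷_) vs) (monics k))
                                   (n≡n′ Fin.zero) (tuples-cong d (n≡n′ ∘ Fin.suc))

  tuples-Unique : ∀ d n → Unique (tuples d n)
  tuples-Unique zero    n = All.[] ∷ []
  tuples-Unique (suc d) n = subst Unique (sym (tuples-cartesian d n))
    (Unique.cartesianProductWith⁺ Vec._∷_ Vec.∷-injective (monics-Unique (n Fin.zero)) (tuples-Unique d (n ∘ Fin.suc)))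

  length-tuples : ∀ d n → length (tuples d n) ≡ q ^ sumAll d n
  length-tuples zero    n = refl
  length-tuples (suc d) n = begin
    length (tuples (suc d) n)                                     ≡⟨ cong length (tuples-cartesian d n) ⟩
    length (cartesianProductWith Vec._∷_ (monics (n Fin.zero)) _) ≡⟨ length-cartesianProductWith Vec._∷_ (monics (n Fin.zero)) _ ⟩
    length (monics (n Fin.zero)) * length (tuples d (n ∘ Fin.suc)) ≡⟨ cong₂ _*_ (length-monics (n Fin.zero)) (length-tuples d (n ∘ Fin.suc)) ⟩
    q ^ n Fin.zero * q ^ sumAll d (n ∘ Fin.suc)                   ≡⟨ ℕ.^-distribˡ-+-* q (n Fin.zero) _ ⟨
    q ^ sumAll (suc d) n                                          ∎
    where open ≡-Reasoning

  ∈-tuples⁻ : ∀ d n {v} → v ∈ tuples d n → ∀ i → length (Vec.lookup v i) ≡ n i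
  ∈-tuples⁻ (suc d) n v∈ i
    with ∈-cartesianProductWith⁻ Vec._∷_ (monics (n Fin.zero)) _ (subst (_ ∈_) (tuples-cartesian d n) v∈)
  ∈-tuples⁻ (suc d) n v∈ Fin.zero    | _ , _ , u∈ , _ , refl = ∈-monics⁻ _ u∈
  ∈-tuples⁻ (suc d) n v∈ (Fin.suc i) | _ , _ , _ , vs∈ , refl = ∈-tuples⁻ d (n ∘ Fin.suc) vs∈ i

  ∈-tuples⁺ : ∀ d n (v : Vec Monic d) → (∀ i → length (Vec.lookup v i) ≡ n i) → v ∈ tuples d n
  ∈-tuples⁺ zero    n Vec.[]       _   = here refl
  ∈-tuples⁺ (suc d) n (u Vec.∷ vs) len = subst (_ ∈_) (sym (tuples-cartesian d n))
    (∈-cartesianProductWith⁺ Vec._∷_ (subst (λ k → u ∈ monics k) (len Fin.zero) (∈-monics u))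
                                     (∈-tuples⁺ d (n ∘ Fin.suc) vs (len ∘ Fin.suc)))

  map-toList-allVec : ∀ k → map toList (allVec k) ≡ monics k
  map-toList-allVec zero    = refl
  map-toList-allVec (suc k) = begin
    map toList (concatMap (λ a → map (a Vec.∷_) (allVec k)) (allFin q))   ≡⟨ List.map-concatMap toList _ (allFin q) ⟩
    concatMap (λ a → map toList (map (a Vec.∷_) (allVec k))) (allFin q)   ≡⟨ List.concatMap-cong (λ a → trans (sym (List.map-∘ (allVec k))) (List.map-∘ (allVec k))) (allFin q) ⟩
    concatMap (λ a → map (a ∷_) (map toList (allVec k))) (allFin q)       ≡⟨ cong (λ us → concatMap (λ a → map (a ∷_) us) (allFin q)) (map-toList-allVec k) ⟩
    concatMap (λ a → map (a ∷_) (monics k)) (allFin q)                    ∎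
    where open ≡-Reasoning

  toVec : ∀ {d n} → Tuple d n → Vec Monic d
  toVec p = Vec.tabulate (toList ∘ p)

  map-toVec-allTuples : ∀ d n → map toVec (allTuples d n) ≡ tuples d n
  map-toVec-allTuples zero    n = refl
  map-toVec-allTuples (suc d) n = begin
    map toVec (concatMap (λ v → map (consT v) (allTuples d (n ∘ Fin.suc))) (allVec (n Fin.zero)))
      ≡⟨ List.map-concatMap toVec _ (allVec (n Fin.zero)) ⟩
    concatMap (λ v → map toVec (map (consT v) (allTuples d (n ∘ Fin.suc)))) (allVec (n Fin.zero))
      ≡⟨ List.concatMap-cong (λ v → trans (sym (List.map-∘ (allTuples d _))) (List.map-∘ (allTuples d _))) (allVec (n Fin.zero)) ⟩
    concatMap (λ v → map (toList v Vec.∷_) (map toVec (allTuples d (n ∘ Fin.suc)))) (allVec (n Fin.zero))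
      ≡⟨ cong (λ vs → concatMap (λ v → map (toList v Vec.∷_) vs) (allVec (n Fin.zero))) (map-toVec-allTuples d (n ∘ Fin.suc)) ⟩
    concatMap (λ v → map (toList v Vec.∷_) (tuples d (n ∘ Fin.suc))) (allVec (n Fin.zero))
      ≡⟨ List.concatMap-map _ toList (allVec (n Fin.zero)) ⟨
    concatMap (λ u → map (u Vec.∷_) (tuples d (n ∘ Fin.suc))) (map toList (allVec (n Fin.zero)))
      ≡⟨ cong (concatMap (λ u → map (u Vec.∷_) (tuples d (n ∘ Fin.suc)))) (map-toList-allVec (n Fin.zero)) ⟩
    tuples (suc d) n ∎
    where open ≡-Reasoning

  -- a tuple c^k ⋆ P with Ψ P is recorded as the pair (c, P); pairs are grouped by the degree j of c
  module Counting {d : ℕ} (k : ℕ) (1≤k : 1 ≤ k) {Ψ : MTuple (suc d) → Set} (Ψ? : Decidable Ψ)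
                  (Ψ-resp : ∀ {P Q} → (∀ i → P i ≡ Q i) → Ψ P → Ψ Q)
                  (Ψ⇒powerFree : ∀ {P} → Ψ P → PowerFree k P) where

    instance
      k≢0 : NonZero k
      k≢0 = >-nonZero 1≤k

    D = suc d

    decomposeᵛ : (v : Vec Monic D) → Decomposition k (Vec.lookup v)
    decomposeᵛ v = decompose k 1≤k (Vec.lookup v)

    cofactorOf : Vec Monic D → MTuple D
    cofactorOf v = cofactor (decomposeᵛ v)

    toPair : Vec Monic D → Monic × Vec Monic D
    toPair v = base (decomposeᵛ v) , Vec.tabulate (cofactorOf v)

    toPair-injective : ∀ {v w} → toPair v ≡ toPair w → v ≡ w
    toPair-injective {v} {w} eq = begin
      v                                                       ≡⟨ recombine v ⟩
      Vec.tabulate (base (decomposeᵛ v) ^ᴹ k ⋆ cofactorOf v)  ≡⟨ Vec.tabulate-cong same-factors ⟩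
      Vec.tabulate (base (decomposeᵛ w) ^ᴹ k ⋆ cofactorOf w)  ≡⟨ recombine w ⟨
      w                                                       ∎
      where
      open ≡-Reasoning
      recombine : ∀ v → v ≡ Vec.tabulate (base (decomposeᵛ v) ^ᴹ k ⋆ cofactorOf v)
      recombine v = trans (sym (Vec.tabulate∘lookup v)) (Vec.tabulate-cong (split (decomposeᵛ v)))
      same-cofactor : ∀ i → cofactorOf v i ≡ cofactorOf w i
      same-cofactor i = trans (sym (Vec.lookup∘tabulate (cofactorOf v) i))
                          (trans (cong (λ t → Vec.lookup t i) (cong proj₂ eq)) (Vec.lookup∘tabulate (cofactorOf w) i))
      same-factors : ∀ i → (base (decomposeᵛ v) ^ᴹ k ⋆ cofactorOf v) i ≡ (base (decomposeᵛ w) ^ᴹ k ⋆ cofactorOf w) i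
      same-factors i = cong₂ (λ b P → b ^ᴹ k · P) (cong proj₁ eq) (same-cofactor i)

    module _ (n : Fin D → ℕ) where

      J : ℕ
      J = minAll D n / k

      Ψ-tuples : ℕ → List (Vec Monic D)
      Ψ-tuples j = filter (Ψ? ∘ Vec.lookup) (tuples D (n ∸ᵛ k * j))

      block : ℕ → List (Monic × Vec Monic D)
      block j = cartesianProduct (monics j) (Ψ-tuples j)

      toPairs : List (Monic × Vec Monic D)
      toPairs = map toPair (filter (Ψ? ∘ cofactorOf) (tuples D n))

      pairs : List (Monic × Vec Monic D)
      pairs = concatMap block (upTo (suc J))

      length-block : ∀ j → length (block j) ≡ q ^ j * length (Ψ-tuples j)
      length-block j = trans (length-cartesianProductWith _,_ (monics j) (Ψ-tuples j))
                             (cong (_* length (Ψ-tuples j)) (length-monics j))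

      ∈-block⁻ : ∀ j {c v} → (c , v) ∈ block j → length c ≡ j × v ∈ tuples D (n ∸ᵛ k * j) × Ψ (Vec.lookup v)
      ∈-block⁻ j cv∈ with ∈-cartesianProduct⁻ (monics j) (Ψ-tuples j) cv∈
      ... | c∈ , v∈ = ∈-monics⁻ _ c∈ , ∈-filter⁻ (Ψ? ∘ Vec.lookup) v∈

      ∈-pairs⁺ : ∀ j {z} → j ≤ J → z ∈ block j → z ∈ pairs
      ∈-pairs⁺ j {z} j≤J z∈ = ∈-concatMap⁺ block (lose {P = λ j → z ∈ block j} (∈-upTo⁺ (s≤s j≤J)) z∈)

      pairs-Unique : Unique pairs
      pairs-Unique = concatMap-Unique block (length ∘ proj₁)
        (λ j → Unique.cartesianProduct⁺ (monics-Unique j) (Unique.filter⁺ (Ψ? ∘ Vec.lookup) (tuples-Unique D (n ∸ᵛ k * j))))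
        (λ j cv∈ → proj₁ (∈-block⁻ j cv∈)) (Unique.upTo⁺ (suc J))

      toPair-∈-pairs : ∀ v → v ∈ tuples D n → Ψ (cofactorOf v) → toPair v ∈ pairs
      toPair-∈-pairs v v∈ Ψv = ∈-pairs⁺ j j≤J (∈-cartesianProduct⁺ (∈-monics c) P∈)
        where
        open ≡-Reasoning
        c = base (decomposeᵛ v)
        P = cofactorOf v
        j = length c
        n≡ : ∀ i → n i ≡ k * j + length (P i)
        n≡ i = begin
          n i                              ≡⟨ ∈-tuples⁻ D n v∈ i ⟨
          length (Vec.lookup v i)          ≡⟨ cong length (split (decomposeᵛ v) i) ⟩
          length (c ^ᴹ k · P i)            ≡⟨ length-· (c ^ᴹ k) (P i) ⟩
          length (c ^ᴹ k) + length (P i)   ≡⟨ cong (_+ length (P i)) (length-^ᴹ c k) ⟩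
          k * j + length (P i)             ∎
        P∈ : Vec.tabulate P ∈ Ψ-tuples j
        P∈ = ∈-filter⁺ (Ψ? ∘ Vec.lookup)
               (∈-tuples⁺ D (n ∸ᵛ k * j) (Vec.tabulate P) λ i → begin
                 length (Vec.lookup (Vec.tabulate P) i)   ≡⟨ cong length (Vec.lookup∘tabulate P i) ⟩
                 length (P i)                             ≡⟨ ℕ.m+n∸m≡n (k * j) _ ⟨
                 k * j + length (P i) ∸ k * j             ≡⟨ cong (_∸ k * j) (n≡ i) ⟨
                 n i ∸ k * j                              ∎)
               (Ψ-resp (λ i → sym (Vec.lookup∘tabulate P i)) Ψv)
        j≤J : j ≤ J
        j≤J = *≤⇒≤/ (minAll-greatest d n (λ i → subst (k * j ≤_) (sym (n≡ i)) (ℕ.m≤m+n (k * j) _)))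

      ∈-toPairs⇒∈-pairs : ∀ {z} → z ∈ toPairs → z ∈ pairs
      ∈-toPairs⇒∈-pairs z∈ = let v , v∈ , z≡ = ∈-map⁻ toPair z∈ in
        subst (_∈ pairs) (sym z≡) (uncurry (toPair-∈-pairs v) (∈-filter⁻ (Ψ? ∘ cofactorOf) v∈))

      pair-∈-toPairs : ∀ c v → length c ≤ J → v ∈ tuples D (n ∸ᵛ k * length c) → Ψ (Vec.lookup v) →
                     (c , v) ∈ toPairs
      pair-∈-toPairs c v c≤J v∈ Ψv =
        subst (_∈ toPairs) toPair-w (∈-map⁺ toPair (∈-filter⁺ (Ψ? ∘ cofactorOf) w∈ Ψw))
        where
        open ≡-Reasoning
        w = Vec.tabulate (c ^ᴹ k ⋆ Vec.lookup v)
        lookup-w : ∀ i → Vec.lookup w i ≡ (c ^ᴹ k ⋆ Vec.lookup v) i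
        lookup-w = Vec.lookup∘tabulate (c ^ᴹ k ⋆ Vec.lookup v)
        determined = decomposition-determined k (decomposeᵛ w) c (Ψ⇒powerFree Ψv) lookup-w
        w∈ : w ∈ tuples D n
        w∈ = ∈-tuples⁺ D n w λ i → begin
          length (Vec.lookup w i)                         ≡⟨ cong length (lookup-w i) ⟩
          length (c ^ᴹ k · Vec.lookup v i)                ≡⟨ length-· (c ^ᴹ k) _ ⟩
          length (c ^ᴹ k) + length (Vec.lookup v i)       ≡⟨ cong₂ _+_ (length-^ᴹ c k) (∈-tuples⁻ D (n ∸ᵛ k * length c) v∈ i) ⟩
          k * length c + (n i ∸ k * length c)             ≡⟨ ℕ.m+[n∸m]≡n (ℕ.≤-trans (≤/⇒*≤ c≤J) (minAll-≤ d n i)) ⟩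
          n i                                             ∎
        Ψw : Ψ (cofactorOf w)
        Ψw = Ψ-resp (λ i → sym (proj₂ determined i)) Ψv
        toPair-w : toPair w ≡ (c , v)
        toPair-w = cong₂ _,_ (proj₁ determined) (trans (Vec.tabulate-cong (proj₂ determined)) (Vec.tabulate∘lookup v))

      ∈-pairs⇒∈-toPairs : ∀ {z} → z ∈ pairs → z ∈ toPairs
      ∈-pairs⇒∈-toPairs {c , v} z∈ =
        let j , j∈ , cv∈ = find (∈-concatMap⁻ block z∈)
            c≡j , v∈ , Ψv = ∈-block⁻ j cv∈
        in pair-∈-toPairs c v (subst (_≤ J) (sym c≡j) (ℕ.≤-pred (∈-upTo⁻ j∈)))
                            (subst (λ j → v ∈ tuples D (n ∸ᵛ k * j)) (sym c≡j) v∈) Ψv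

      count-by-decomposition :
        length (filter (Ψ? ∘ cofactorOf) (tuples D n)) ≡ sumTo J (λ j → q ^ j * length (Ψ-tuples j))
      count-by-decomposition = begin
        length (filter (Ψ? ∘ cofactorOf) (tuples D n))
          ≡⟨ List.length-map toPair (filter (Ψ? ∘ cofactorOf) (tuples D n)) ⟨
        length toPairs
          ≡⟨ length-Unique-≡ (Unique.map⁺ toPair-injective (Unique.filter⁺ (Ψ? ∘ cofactorOf) (tuples-Unique D n)))
                             pairs-Unique (mk⇔ ∈-toPairs⇒∈-pairs ∈-pairs⇒∈-toPairs) ⟩
        length pairs                                   ≡⟨ length-concatMap-upTo block J ⟩
        sumTo J (λ j → length (block j))               ≡⟨ sumTo-cong J (λ j _ → length-block j) ⟩
        sumTo J (λ j → q ^ j * length (Ψ-tuples j))    ∎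
        where open ≡-Reasoning

  powerFreeCount : ∀ {d} k → 1 ≤ k → (Fin (suc d) → ℕ) → ℕ
  powerFreeCount {d} k 1≤k n = length (filter (powerFree? k 1≤k ∘ Vec.lookup) (tuples (suc d) n))

  powerFreeCount-cong : ∀ {d} k 1≤k {n n′ : Fin (suc d) → ℕ} → (∀ i → n i ≡ n′ i) →
    powerFreeCount k 1≤k n ≡ powerFreeCount k 1≤k n′
  powerFreeCount-cong {d} k 1≤k n≡n′ =
    cong (length ∘ filter (powerFree? k 1≤k ∘ Vec.lookup)) (tuples-cong (suc d) n≡n′)

  q^N≡sum-powerFreeCount : ∀ {d} k (1≤k : 1 ≤ k) (n : Fin (suc d) → ℕ) → let instance _ = >-nonZero 1≤k in
    q ^ sumAll (suc d) n ≡ sumTo (minAll (suc d) n / k) (λ j → q ^ j * powerFreeCount k 1≤k (n ∸ᵛ k * j))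
  q^N≡sum-powerFreeCount {d} k 1≤k n = begin
    q ^ sumAll (suc d) n                                           ≡⟨ length-tuples (suc d) n ⟨
    length (tuples (suc d) n)                                      ≡⟨ cong length (List.filter-all (powerFree? k 1≤k ∘ C.cofactorOf) {tuples (suc d) n} (All.tabulate λ {v} _ → cofactor-powerFree (decompose k 1≤k (Vec.lookup v)))) ⟨
    length (filter (powerFree? k 1≤k ∘ C.cofactorOf) (tuples (suc d) n)) ≡⟨ C.count-by-decomposition n ⟩
    sumTo (minAll (suc d) n / k) (λ j → q ^ j * powerFreeCount k 1≤k (n ∸ᵛ k * j)) ∎
    where
    open ≡-Reasoning
    module C = Counting k 1≤k {Ψ = PowerFree k} (powerFree? k 1≤k) (PowerFree-resp {k = k}) id

  module _ {d : ℕ} (r : ℕ) (1≤r : 1 ≤ r) (n : Fin (suc d) → ℕ) where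

    private
      instance
        r≢0 : NonZero r
        r≢0 = >-nonZero 1≤r
      term : (Fin (suc d) → ℕ) → ℕ → ℕ
      term n′ j = q ^ j * powerFreeCount r 1≤r (n′ ∸ᵛ r * j)
      term-zero : ∀ n′ → term n′ 0 ≡ powerFreeCount r 1≤r n′
      term-zero n′ = trans (ℕ.+-identityʳ _) (powerFreeCount-cong r 1≤r (λ i → cong (n′ i ∸_) (ℕ.*-zeroʳ r)))

    powerFreeCount-small : minAll (suc d) n < r → powerFreeCount r 1≤r n ≡ q ^ sumAll (suc d) n
    powerFreeCount-small μ<r = sym (begin
      q ^ sumAll (suc d) n               ≡⟨ q^N≡sum-powerFreeCount r 1≤r n ⟩
      sumTo (minAll (suc d) n / r) (term n) ≡⟨ cong (λ J → sumTo J (term n)) (m<n⇒m/n≡0 μ<r) ⟩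
      term n 0                           ≡⟨ term-zero n ⟩
      powerFreeCount r 1≤r n             ∎)
      where open ≡-Reasoning

    -- split off the j = 0 term; the remaining terms are the expansion for n ∸ r, scaled by q
    powerFreeCount-large : r ≤ minAll (suc d) n →
      powerFreeCount r 1≤r n + q * q ^ sumAll (suc d) (n ∸ᵛ r) ≡ q ^ sumAll (suc d) n
    powerFreeCount-large r≤μ = sym (begin
      q ^ sumAll (suc d) n                                 ≡⟨ q^N≡sum-powerFreeCount r 1≤r n ⟩
      sumTo (μ / r) (term n)                               ≡⟨ cong (λ J → sumTo J (term n)) (m/n≡1+[m∸n]/n r≤μ) ⟩
      sumTo (suc ((μ ∸ r) / r)) (term n)                   ≡⟨ sumTo-suc ((μ ∸ r) / r) (term n) ⟩
      term n 0 + sumTo ((μ ∸ r) / r) (term n ∘ suc)        ≡⟨ cong₂ _+_ (term-zero n) (sumTo-cong ((μ ∸ r) / r) (λ j _ → term-suc j)) ⟩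
      powerFreeCount r 1≤r n + sumTo ((μ ∸ r) / r) (λ j → q * term (n ∸ᵛ r) j)
        ≡⟨ cong (powerFreeCount r 1≤r n +_) (*-distribˡ-sumTo ((μ ∸ r) / r) q (term (n ∸ᵛ r))) ⟨
      powerFreeCount r 1≤r n + q * sumTo ((μ ∸ r) / r) (term (n ∸ᵛ r))
        ≡⟨ cong (λ μ′ → powerFreeCount r 1≤r n + q * sumTo (μ′ / r) (term (n ∸ᵛ r))) (minAll-∸ᵛ d n r) ⟨
      powerFreeCount r 1≤r n + q * sumTo (minAll (suc d) (n ∸ᵛ r) / r) (term (n ∸ᵛ r))
        ≡⟨ cong (λ x → powerFreeCount r 1≤r n + q * x) (q^N≡sum-powerFreeCount r 1≤r (n ∸ᵛ r)) ⟨
      powerFreeCount r 1≤r n + q * q ^ sumAll (suc d) (n ∸ᵛ r) ∎)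
      where
      open ≡-Reasoning
      μ = minAll (suc d) n
      term-suc : ∀ j → term n (suc j) ≡ q * term (n ∸ᵛ r) j
      term-suc j = trans (ℕ.*-assoc q (q ^ j) _) (cong (λ x → q * (q ^ j * x))
        (powerFreeCount-cong r 1≤r (λ i → trans (cong (n i ∸_) (ℕ.*-suc r j)) (sym (ℕ.∸-+-assoc (n i) r (r * j))))))

  module _ {d : ℕ} (r m : ℕ) .{{_ : NonZero m}} (1≤r : 1 ≤ r) (r<m : r < m) where

    private
      1≤m : 1 ≤ m
      1≤m = ℕ.≤-trans 1≤r (ℕ.<⇒≤ r<m)
      module C = Counting {d} m 1≤m {Ψ = PowerFree r} (powerFree? r 1≤r) (PowerFree-resp {k = r}) (λ {P} → PowerFree-mono P (ℕ.<⇒≤ r<m))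

    Good⇔PowerFree-cofactor : ∀ {n} (p : Tuple (suc d) n) → Good r m p ⇔ PowerFree r (C.cofactorOf (toVec {n = n} p))
    Good⇔PowerFree-cofactor {n} p = mk⇔
      (λ good → good⇒powerFree r m r<m 1≤r (base Dp) (cofactor Dp) (cofactor-powerFree Dp)
                  (IsGood-resp r m {P = toList ∘ p} {Q = base Dp ^ᴹ m ⋆ cofactor Dp}
                    (λ i → trans (sym (lookup-toVec i)) (split Dp i)) (Good⇒IsGood r m p good)))
      (λ free → IsGood⇒Good r m p
                  (IsGood-resp r m {P = base Dp ^ᴹ m ⋆ cofactor Dp} {Q = toList ∘ p} (λ i → trans (sym (split Dp i)) (lookup-toVec i))
                    (powerFree⇒good r m r<m (base Dp) (cofactor Dp) free)))
      where
      Dp = C.decomposeᵛ (toVec {n = n} p)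
      lookup-toVec : ∀ i → Vec.lookup (toVec {n = n} p) i ≡ toList (p i)
      lookup-toVec = Vec.lookup∘tabulate (toList ∘ p)

    count-Good : ∀ n (good? : Decidable (Good {suc d} {n} r m)) →
      length (filter good? (allTuples (suc d) n)) ≡
      sumTo (minAll (suc d) n / m) (λ j → q ^ j * powerFreeCount r 1≤r (n ∸ᵛ m * j))
    count-Good n good? = begin
      length (filter good? (allTuples (suc d) n))
        ≡⟨ cong length (List.filter-≐ good? (Ψ? ∘ toVec′) Good≐ (allTuples (suc d) n)) ⟩
      length (filter (Ψ? ∘ toVec′) (allTuples (suc d) n))
        ≡⟨ length-filter-map Ψ? toVec′ (allTuples (suc d) n) ⟨
      length (filter Ψ? (map toVec′ (allTuples (suc d) n)))
        ≡⟨ cong (length ∘ filter Ψ?) (map-toVec-allTuples (suc d) n) ⟩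
      length (filter Ψ? (tuples (suc d) n))
        ≡⟨ C.count-by-decomposition n ⟩
      sumTo (minAll (suc d) n / m) (λ j → q ^ j * powerFreeCount r 1≤r (n ∸ᵛ m * j)) ∎
      where
      open ≡-Reasoning
      toVec′ : Tuple (suc d) n → Vec Monic (suc d)
      toVec′ = toVec
      Ψ? : Decidable (PowerFree r ∘ C.cofactorOf)
      Ψ? = powerFree? r 1≤r ∘ C.cofactorOf
      Good≐ : Good {suc d} {n} r m ≐ (PowerFree r ∘ C.cofactorOf ∘ toVec′)
      Good≐ = (λ {p} → Equivalence.to (Good⇔PowerFree-cofactor p)) , (λ {p} → Equivalence.from (Good⇔PowerFree-cofactor p))


module Summands {q : ℕ} (F : FiniteField q) {d : ℕ} (r m : ℕ) (1≤r : 1 ≤ r) (n : Fin (suc d) → ℕ) where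

  open Polynomials F

  D = suc d
  N = sumAll D n
  μ = minAll D n

  T A B : ℕ → ℕ
  T j = q ^ j * powerFreeCount r 1≤r (n ∸ᵛ m * j)
  A j = q ^ (N + j ∸ j * m * D)
  B j = q ^ (N + 1 + j ∸ (r * D + j * m * D))

  module _ {j} (mj≤μ : m * j ≤ μ) where

    private
      n′ = n ∸ᵛ m * j
      N′ = sumAll D n′

      N′+ : N′ + j * m * D ≡ N
      N′+ = trans (cong (N′ +_) (trans (ℕ.*-comm (j * m) D) (cong (D *_) (ℕ.*-comm j m))))
                  (sumAll-∸ᵛ D n (m * j) (λ i → ℕ.≤-trans mj≤μ (minAll-≤ d n i)))

      q^j*q^N′ : q ^ j * q ^ N′ ≡ A j
      q^j*q^N′ = trans (sym (ℕ.^-distribˡ-+-* q j N′)) (cong (q ^_) (sym (+-∸-cancel j N′+)))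

    μ′≡ : minAll D n′ ≡ μ ∸ m * j
    μ′≡ = minAll-∸ᵛ d n (m * j)

    T≡A : μ ∸ m * j < r → T j ≡ A j
    T≡A μ′<r = trans (cong (q ^ j *_) (powerFreeCount-small r 1≤r n′ (subst (_< r) (sym μ′≡) μ′<r))) q^j*q^N′

    T+B≡A : r ≤ μ ∸ m * j → T j + B j ≡ A j
    T+B≡A r≤μ′ = begin
      T j + B j                                           ≡⟨ cong (T j +_) B≡ ⟨
      q ^ j * Dr + q ^ j * (q * q ^ N″)                   ≡⟨ ℕ.*-distribˡ-+ (q ^ j) Dr _ ⟨
      q ^ j * (Dr + q * q ^ N″)                           ≡⟨ cong (q ^ j *_) (powerFreeCount-large r 1≤r n′ r≤μ′′) ⟩
      q ^ j * q ^ N′                                      ≡⟨ q^j*q^N′ ⟩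
      A j                                                 ∎
      where
      open ≡-Reasoning
      r≤μ′′ = subst (r ≤_) (sym μ′≡) r≤μ′
      Dr = powerFreeCount r 1≤r n′
      N″ = sumAll D (n′ ∸ᵛ r)
      N″+ : suc N″ + (r * D + j * m * D) ≡ N + 1
      N″+ = begin
        suc N″ + (r * D + j * m * D)    ≡⟨ cong suc (ℕ.+-assoc N″ (r * D) _) ⟨
        suc (N″ + r * D + j * m * D)    ≡⟨ cong (λ x → suc (N″ + x + j * m * D)) (ℕ.*-comm r D) ⟩
        suc (N″ + D * r + j * m * D)    ≡⟨ cong (λ x → suc (x + j * m * D)) (sumAll-∸ᵛ D n′ r (λ i → ℕ.≤-trans r≤μ′′ (minAll-≤ d n′ i))) ⟩
        suc (N′ + j * m * D)            ≡⟨ cong suc N′+ ⟩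
        suc N                           ≡⟨ ℕ.+-comm 1 N ⟩
        N + 1                           ∎
      B≡ : q ^ j * (q * q ^ N″) ≡ B j
      B≡ = trans (sym (ℕ.^-distribˡ-+-* q j (suc N″))) (cong (q ^_) (sym (+-∸-cancel j N″+)))

proposition4p4 : (q : ℕ) → IsPrimePower q → (F : FiniteField q) →
    (d r m : ℕ) → .{{_ : NonZero m}} → 1 ≤ d → 1 ≤ r → r < m →
    (n : Fin d → ℕ) →
    (good? : Decidable (Poly.Good F {d} {n} r m)) →
    let N = sumAll d n
        μ = minAll d n
        count = length (filter good? (Poly.allTuples F d n))
        S₁ = sumTo (μ / m) (λ j → q ^ (N + j ∸ j * m * d))
        S₂ = sumTo ((μ ∸ r) / m) (λ j → q ^ (N + 1 + j ∸ (r * d + j * m * d)))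
    in (μ < r → count ≡ S₁) × (r ≤ μ → count + S₂ ≡ S₁)
proposition4p4 q _ F zero    r m () 1≤r r<m n good?
proposition4p4 q _ F (suc d) r m _  1≤r r<m n good? = few-factors , many-factors
  where
  open Polynomials F
  open Summands F r m 1≤r n
  count : ℕ
  count = length (filter good? (Poly.allTuples F (suc d) n))
  count≡ : count ≡ sumTo (μ / m) T
  count≡ = count-Good r m 1≤r r<m n good?
  few-factors : μ < r → count ≡ sumTo (μ / m) A
  few-factors μ<r = trans count≡ (sumTo-cong (μ / m) λ j j≤J →
    T≡A (≤/⇒*≤ j≤J) (ℕ.≤-<-trans (ℕ.m∸n≤m μ (m * j)) μ<r))
  many-factors : r ≤ μ → count + sumTo ((μ ∸ r) / m) B ≡ sumTo (μ / m) A
  many-factors r≤μ = trans (cong (_+ sumTo ((μ ∸ r) / m) B) count≡) (sumTo-+-partial (μ / m) T B A (/-monoˡ-≤ m (ℕ.m∸n≤m μ r))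
    (λ j j≤J′ → T+B≡A (ℕ.≤-trans (≤/⇒*≤ j≤J′) (ℕ.m∸n≤m μ r)) (∸-swap-≤ r≤μ (≤/⇒*≤ j≤J′)))
    (λ j J′<j j≤J → T≡A (≤/⇒*≤ j≤J) (ℕ.≰⇒> λ r≤μ∸mj → ℕ.<⇒≱ J′<j (*≤⇒≤/ (∸-swap-≤ (≤/⇒*≤ j≤J) r≤μ∸mj)))))
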